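{- Let $T$ be a theory in the language of category theory plus constants, $\Gamma$ a context, $\Delta$ a context extending $\Gamma$, $\Delta_1,\Delta_2$ copies of $\Delta$ obtained by renaming its variables, and $P(\Delta)$ a formula in context $(\Gamma,\Delta)$. Then $T$ proves that for every context isomorphism $\tau:\Delta_1\cong\Delta_2$, $P(\Delta_1)\leftrightarrow P(\Delta_2)$.
   Context: The language of category theory is a dependently sorted first-order language (intuitionistic logic) with a sort of objects and, for object-terms $X,Y$, a sort of arrows $X\to Y$, identity arrow-terms $1_X$, composition $g\circ f$, and atomic formulas $f=g$ only for arrow-terms of the same sort (no equality of objects). Constants: object constants and arrow constants between object constants. Theories contain the category axioms and axioms that $=$ is an equivalence relation preserved by composition. A context is a list of distinct typed variables in which each arrow variable's source and target are constants or earlier variables; $\Delta$ extends $\Gamma$ if the concatenation $(\Gamma,\Delta)$ is a context. For each variable $V$ of $\Delta$, $\Delta_i$ has variable $V_i$ of the correspondingly renamed sort. A context isomorphism $\tau:\Delta_1\cong\Delta_2$ is, for each object variable $V$ of $\Delta$, an arrow $f_V:V_1\to V_2$ (setting $f_S:=1_S$ for object-terms $S$ in context $\Gamma$) such that each $f_V$ is an isomorphism and for every arrow variable $g:A\to B$ of $\Delta$, $g_2\circ f_A=f_B\circ g_1$; this is expressible as a finite conjunction. -}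

module Defs where

-- CONVENTIONS
-- * A context is a cons-list of entries whose HEAD is the LAST variable.
--   Variable index n (de Bruijn) refers to the n-th entry from the head.
--   An entry's object terms are relative to the part of the context after
--   (i.e. to the right of) that entry in the list.
-- * Hence the concatenated context (Γ,Δ) of the paper is the list  Δ ++ Γ.
-- * There is a single index space; typing decides whether index n is an
--   object variable or an arrow variable.

open import Data.Nat using (ℕ; zero; suc; _+_; _<ᵇ_; _≡ᵇ_)
open import Data.Bool using (Bool; true; false; if_then_else_)
open import Data.List using (List; []; _∷_; _++_; length; map; foldr)
open import Data.List.Membership.Propositional using (_∈_)
open import Data.Maybe using (Maybe; just; nothing; maybe)

record Signature : Set₁ where
  field
    ObC : Set
    ArC : Set
    src : ArC → ObC
    tgt : ArC → ObC

module Lang (S : Signature) where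
  open Signature S

  data ObT : Set where
    oc : ObC → ObT
    ov : ℕ → ObT

  data ArT : Set where
    ac   : ArC → ArT
    av   : ℕ → ArT
    idt  : ObT → ArT
    comp : ArT → ArT → ArT  -- comp g f  is  g ∘ f

  data Entry : Set where
    obj : Entry
    arr : ObT → ObT → Entry

  Ctx : Set
  Ctx = List Entry

  infix  6 _≐_
  infixr 5 _∧'_
  infixr 4 _∨'_
  infixr 3 _⇒'_

  data Fm : Set where
    _≐_  : ArT → ArT → Fm
    ⊤'   : Fm
    ⊥'   : Fm
    _∧'_ : Fm → Fm → Fm
    _∨'_ : Fm → Fm → Fm
    _⇒'_ : Fm → Fm → Fm
    ∀'   : Entry → Fm → Fm
    ∃'   : Entry → Fm → Fm

  infixr 3 _⇔'_
  _⇔'_ : Fm → Fm → Fm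
  φ ⇔' ψ = (φ ⇒' ψ) ∧' (ψ ⇒' φ)

  Ren : Set
  Ren = ℕ → ℕ

  liftR : Ren → Ren
  liftR ρ zero    = zero
  liftR ρ (suc n) = suc (ρ n)

  renO : Ren → ObT → ObT
  renO ρ (oc c) = oc c
  renO ρ (ov n) = ov (ρ n)

  renA : Ren → ArT → ArT
  renA ρ (ac f)     = ac f
  renA ρ (av n)     = av (ρ n)
  renA ρ (idt a)    = idt (renO ρ a)
  renA ρ (comp g f) = comp (renA ρ g) (renA ρ f)

  renE : Ren → Entry → Entry
  renE ρ obj       = obj
  renE ρ (arr a b) = arr (renO ρ a) (renO ρ b)

  renF : Ren → Fm → Fm
  renF ρ (f ≐ g)   = renA ρ f ≐ renA ρ g
  renF ρ ⊤'        = ⊤'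
  renF ρ ⊥'        = ⊥'
  renF ρ (φ ∧' ψ)  = renF ρ φ ∧' renF ρ ψ
  renF ρ (φ ∨' ψ)  = renF ρ φ ∨' renF ρ ψ
  renF ρ (φ ⇒' ψ)  = renF ρ φ ⇒' renF ρ ψ
  renF ρ (∀' e φ)  = ∀' (renE ρ e) (renF (liftR ρ) φ)
  renF ρ (∃' e φ)  = ∃' (renE ρ e) (renF (liftR ρ) φ)

  wkF : Fm → Fm
  wkF = renF suc

  record Sub : Set where
    field
      so : ℕ → ObT
      sa : ℕ → ArT
  open Sub

  liftS : Sub → Sub
  so (liftS σ) zero    = ov zero
  so (liftS σ) (suc n) = renO suc (so σ n)
  sa (liftS σ) zero    = av zero
  sa (liftS σ) (suc n) = renA suc (sa σ n)

  subO : Sub → ObT → ObT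
  subO σ (oc c) = oc c
  subO σ (ov n) = so σ n

  subA : Sub → ArT → ArT
  subA σ (ac f)     = ac f
  subA σ (av n)     = sa σ n
  subA σ (idt a)    = idt (subO σ a)
  subA σ (comp g f) = comp (subA σ g) (subA σ f)

  subE : Sub → Entry → Entry
  subE σ obj       = obj
  subE σ (arr a b) = arr (subO σ a) (subO σ b)

  subF : Sub → Fm → Fm
  subF σ (f ≐ g)  = subA σ f ≐ subA σ g
  subF σ ⊤'       = ⊤'
  subF σ ⊥'       = ⊥'
  subF σ (φ ∧' ψ) = subF σ φ ∧' subF σ ψ
  subF σ (φ ∨' ψ) = subF σ φ ∨' subF σ ψ
  subF σ (φ ⇒' ψ) = subF σ φ ⇒' subF σ ψ
  subF σ (∀' e φ) = ∀' (subE σ e) (subF (liftS σ) φ)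
  subF σ (∃' e φ) = ∃' (subE σ e) (subF (liftS σ) φ)

  -- substitute an object term / arrow term for variable 0
  -- (the other component at index 0 is never used on well-formed input)
  sub0O : ObT → Sub
  so (sub0O t) zero    = t
  so (sub0O t) (suc n) = ov n
  sa (sub0O t) zero    = av zero
  sa (sub0O t) (suc n) = av n

  sub0A : ArT → Sub
  so (sub0A u) zero    = ov zero
  so (sub0A u) (suc n) = ov n
  sa (sub0A u) zero    = u
  sa (sub0A u) (suc n) = av n

  -- variable n of Γ has sort e (expressed in the whole of Γ)
  data _∋_∶_ : Ctx → ℕ → Entry → Set where
    here  : ∀ {Γ e} → (e ∷ Γ) ∋ zero ∶ renE suc e
    there : ∀ {Γ e e' n} → Γ ∋ n ∶ e → (e' ∷ Γ) ∋ suc n ∶ renE suc e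

  data _⊢o_ (Γ : Ctx) : ObT → Set where
    oc : ∀ c → Γ ⊢o oc c
    ov : ∀ {n} → Γ ∋ n ∶ obj → Γ ⊢o ov n

  data _⊢a_∶_⇒_ (Γ : Ctx) : ArT → ObT → ObT → Set where
    ac   : ∀ f → Γ ⊢a ac f ∶ oc (src f) ⇒ oc (tgt f)
    av   : ∀ {n a b} → Γ ∋ n ∶ arr a b → Γ ⊢a av n ∶ a ⇒ b
    idt  : ∀ {a} → Γ ⊢o a → Γ ⊢a idt a ∶ a ⇒ a
    comp : ∀ {g f a b c} → Γ ⊢a g ∶ b ⇒ c → Γ ⊢a f ∶ a ⇒ b →
           Γ ⊢a comp g f ∶ a ⇒ c

  data _⊢e_ (Γ : Ctx) : Entry → Set where
    obj : Γ ⊢e obj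
    arr : ∀ {a b} → Γ ⊢o a → Γ ⊢o b → Γ ⊢e arr a b

  data ⊢ctx : Ctx → Set where
    []  : ⊢ctx []
    _∷_ : ∀ {Γ e} → Γ ⊢e e → ⊢ctx Γ → ⊢ctx (e ∷ Γ)

  data _⊢f_ (Γ : Ctx) : Fm → Set where
    eq  : ∀ {f g a b} → Γ ⊢a f ∶ a ⇒ b → Γ ⊢a g ∶ a ⇒ b → Γ ⊢f (f ≐ g)
    top : Γ ⊢f ⊤'
    bot : Γ ⊢f ⊥'
    and : ∀ {φ ψ} → Γ ⊢f φ → Γ ⊢f ψ → Γ ⊢f (φ ∧' ψ)
    or  : ∀ {φ ψ} → Γ ⊢f φ → Γ ⊢f ψ → Γ ⊢f (φ ∨' ψ)
    imp : ∀ {φ ψ} → Γ ⊢f φ → Γ ⊢f ψ → Γ ⊢f (φ ⇒' ψ)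
    all : ∀ {e φ} → Γ ⊢e e → (e ∷ Γ) ⊢f φ → Γ ⊢f ∀' e φ
    ex  : ∀ {e φ} → Γ ⊢e e → (e ∷ Γ) ⊢f φ → Γ ⊢f ∃' e φ

  data CatAx : Fm → Set where
    -- ∀X Y ∀f:X→Y. 1_Y ∘ f = f
    idL   : CatAx (∀' obj (∀' obj (∀' (arr (ov 1) (ov 0))
              (comp (idt (ov 1)) (av 0) ≐ av 0))))
    -- ∀X Y ∀f:X→Y. f ∘ 1_X = f
    idR   : CatAx (∀' obj (∀' obj (∀' (arr (ov 1) (ov 0))
              (comp (av 0) (idt (ov 2)) ≐ av 0))))
    -- ∀W X Y Z ∀f:W→X ∀g:X→Y ∀h:Y→Z. h∘(g∘f) = (h∘g)∘f
    assoc : CatAx (∀' obj (∀' obj (∀' obj (∀' obj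
              (∀' (arr (ov 3) (ov 2)) (∀' (arr (ov 3) (ov 2))
              (∀' (arr (ov 3) (ov 2))
              (comp (av 0) (comp (av 1) (av 2))
                ≐ comp (comp (av 0) (av 1)) (av 2)))))))))
    -- ∀X Y ∀f:X→Y. f = f
    refl' : CatAx (∀' obj (∀' obj (∀' (arr (ov 1) (ov 0)) (av 0 ≐ av 0))))
    -- ∀X Y ∀f g:X→Y. f = g ⇒ g = f
    sym'  : CatAx (∀' obj (∀' obj (∀' (arr (ov 1) (ov 0))
              (∀' (arr (ov 2) (ov 1)) (av 1 ≐ av 0 ⇒' av 0 ≐ av 1)))))
    -- ∀X Y ∀f g h:X→Y. f = g ⇒ g = h ⇒ f = h
    trans' : CatAx (∀' obj (∀' obj (∀' (arr (ov 1) (ov 0))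
              (∀' (arr (ov 2) (ov 1)) (∀' (arr (ov 3) (ov 2))
              (av 2 ≐ av 1 ⇒' av 1 ≐ av 0 ⇒' av 2 ≐ av 0))))))
    -- ∀X Y Z ∀f f':X→Y ∀g g':Y→Z. f = f' ⇒ g = g' ⇒ g∘f = g'∘f'
    cong∘ : CatAx (∀' obj (∀' obj (∀' obj
              (∀' (arr (ov 2) (ov 1)) (∀' (arr (ov 3) (ov 2))
              (∀' (arr (ov 3) (ov 2)) (∀' (arr (ov 4) (ov 3))
              (av 3 ≐ av 2 ⇒' av 1 ≐ av 0 ⇒'
                 comp (av 1) (av 3) ≐ comp (av 0) (av 2)))))))))

  record Theory : Set₁ where
    field
      Ax     : Fm → Set
      Ax-wf  : ∀ {φ} → Ax φ → [] ⊢f φ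
      Ax-cat : ∀ {φ} → CatAx φ → Ax φ
  open Theory

  infix 2 _▸_∣_⊢_
  data _▸_∣_⊢_ (T : Theory) : Ctx → List Fm → Fm → Set where
    hyp  : ∀ {Γ Φ φ} → φ ∈ Φ → T ▸ Γ ∣ Φ ⊢ φ
    ax   : ∀ {Γ Φ φ} → Ax T φ → T ▸ Γ ∣ Φ ⊢ φ
    ⊤I   : ∀ {Γ Φ} → T ▸ Γ ∣ Φ ⊢ ⊤'
    ⊥E   : ∀ {Γ Φ φ} → Γ ⊢f φ → T ▸ Γ ∣ Φ ⊢ ⊥' → T ▸ Γ ∣ Φ ⊢ φ
    ∧I   : ∀ {Γ Φ φ ψ} → T ▸ Γ ∣ Φ ⊢ φ → T ▸ Γ ∣ Φ ⊢ ψ → T ▸ Γ ∣ Φ ⊢ φ ∧' ψ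
    ∧E₁  : ∀ {Γ Φ φ ψ} → T ▸ Γ ∣ Φ ⊢ φ ∧' ψ → T ▸ Γ ∣ Φ ⊢ φ
    ∧E₂  : ∀ {Γ Φ φ ψ} → T ▸ Γ ∣ Φ ⊢ φ ∧' ψ → T ▸ Γ ∣ Φ ⊢ ψ
    ∨I₁  : ∀ {Γ Φ φ ψ} → Γ ⊢f ψ → T ▸ Γ ∣ Φ ⊢ φ → T ▸ Γ ∣ Φ ⊢ φ ∨' ψ
    ∨I₂  : ∀ {Γ Φ φ ψ} → Γ ⊢f φ → T ▸ Γ ∣ Φ ⊢ ψ → T ▸ Γ ∣ Φ ⊢ φ ∨' ψ
    ∨E   : ∀ {Γ Φ φ ψ χ} → T ▸ Γ ∣ Φ ⊢ φ ∨' ψ →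
           T ▸ Γ ∣ φ ∷ Φ ⊢ χ → T ▸ Γ ∣ ψ ∷ Φ ⊢ χ → T ▸ Γ ∣ Φ ⊢ χ
    ⇒I   : ∀ {Γ Φ φ ψ} → Γ ⊢f φ → T ▸ Γ ∣ φ ∷ Φ ⊢ ψ → T ▸ Γ ∣ Φ ⊢ φ ⇒' ψ
    ⇒E   : ∀ {Γ Φ φ ψ} → T ▸ Γ ∣ Φ ⊢ φ ⇒' ψ → T ▸ Γ ∣ Φ ⊢ φ → T ▸ Γ ∣ Φ ⊢ ψ
    ∀I   : ∀ {Γ Φ e φ} → Γ ⊢e e → T ▸ e ∷ Γ ∣ map wkF Φ ⊢ φ →
           T ▸ Γ ∣ Φ ⊢ ∀' e φ
    ∀Eo  : ∀ {Γ Φ φ t} → T ▸ Γ ∣ Φ ⊢ ∀' obj φ → Γ ⊢o t →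
           T ▸ Γ ∣ Φ ⊢ subF (sub0O t) φ
    ∀Ea  : ∀ {Γ Φ φ a b u} → T ▸ Γ ∣ Φ ⊢ ∀' (arr a b) φ → Γ ⊢a u ∶ a ⇒ b →
           T ▸ Γ ∣ Φ ⊢ subF (sub0A u) φ
    ∃Io  : ∀ {Γ Φ φ t} → (obj ∷ Γ) ⊢f φ → Γ ⊢o t →
           T ▸ Γ ∣ Φ ⊢ subF (sub0O t) φ → T ▸ Γ ∣ Φ ⊢ ∃' obj φ
    ∃Ia  : ∀ {Γ Φ φ a b u} → Γ ⊢e arr a b → (arr a b ∷ Γ) ⊢f φ →
           Γ ⊢a u ∶ a ⇒ b →
           T ▸ Γ ∣ Φ ⊢ subF (sub0A u) φ → T ▸ Γ ∣ Φ ⊢ ∃' (arr a b) φ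
    ∃E   : ∀ {Γ Φ e φ χ} → T ▸ Γ ∣ Φ ⊢ ∃' e φ →
           T ▸ e ∷ Γ ∣ φ ∷ map wkF Φ ⊢ wkF χ → T ▸ Γ ∣ Φ ⊢ χ

  ∀* : Ctx → Fm → Fm
  ∀* []      φ = φ
  ∀* (e ∷ Ξ) φ = ∀* Ξ (∀' e φ)

  -- The big context is  (Γ, Δ₁, Δ₂, F)  =  F ++ copy₂ Δ ++ Δ ++ Γ,
  -- where F contains one arrow variable f_V : V₁ → V₂ per object
  -- variable V of Δ.

  above : ℕ → ℕ → Ren
  above c m n = if n <ᵇ c then n else n + m

  obPos : ℕ → Ctx → List ℕ
  obPos i []          = []
  obPos i (obj ∷ Δ)   = i ∷ obPos (suc i) Δ
  obPos i (arr _ _ ∷ Δ) = obPos (suc i) Δ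

  -- index (within F) of f_V for the object variable at position j
  fOf : List ℕ → ℕ → Maybe ℕ
  fOf []       j = nothing
  fOf (i ∷ is) j = if i ≡ᵇ j then just zero else Data.Maybe.map suc (fOf is j)

  module Iso (Δ : Ctx) where
    m : ℕ
    m = length Δ

    os : List ℕ
    os = obPos zero Δ

    k : ℕ
    k = length os

    -- Δ₁ is Δ itself (it directly follows Γ)
    copy₁ : Ctx
    copy₁ = Δ

    -- Δ₂: references to Γ skip over Δ₁
    copy₂' : Ctx → Ctx
    copy₂' []       = []
    copy₂' (e ∷ Ξ) = renE (above (length Ξ) m) e ∷ copy₂' Ξ

    copy₂ : Ctx
    copy₂ = copy₂' Δ

    -- the variables f_V : V₁ → V₂
    isoArrows' : List ℕ → Ctx
    isoArrows' []       = []
    isoArrows' (i ∷ is) =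
      arr (ov (i + m + length is)) (ov (i + length is)) ∷ isoArrows' is

    isoArrows : Ctx
    isoArrows = isoArrows' os

    ctxIsoVars : Ctx
    ctxIsoVars = isoArrows ++ copy₂ ++ copy₁

    -- renamings from context (Γ,Δ) into the big context sending Δ to Δ₁,
    -- resp. Δ to Δ₂ (and Γ to Γ)
    r₁ : Ren
    r₁ n = n + (m + k)

    r₂ : Ren
    r₂ n = if n <ᵇ m then n + k else n + (m + k)

    P₁ : Fm → Fm
    P₁ = renF r₁

    P₂ : Fm → Fm
    P₂ = renF r₂

    -- f_S for an object term S of context (Γ,Δ): f_V if S is a variable V
    -- of Δ, and 1_S otherwise
    fTerm : ObT → ArT
    fTerm (oc c) = idt (oc c)
    fTerm (ov j) = maybe av (idt (ov (r₁ j))) (fOf os j)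

    -- conditions, one per variable of Δ (i = its index in (Γ,Δ))
    conds : ℕ → Ctx → List Fm
    conds i []            = []
    conds i (obj ∷ Ξ)     =
      -- f_V is an isomorphism: ∃ h : V₂ → V₁. h ∘ f_V = 1 ∧ f_V ∘ h = 1
      ∃' (arr (ov (r₂ i)) (ov (r₁ i)))
        ( comp (av zero) (renA suc (fTerm (ov i))) ≐ idt (ov (suc (r₁ i)))
        ∧' comp (renA suc (fTerm (ov i))) (av zero) ≐ idt (ov (suc (r₂ i))))
      ∷ conds (suc i) Ξ
    conds i (arr a b ∷ Ξ) =
      -- g : A → B :   g₂ ∘ f_A = f_B ∘ g₁
      (comp (av (r₂ i)) (fTerm (renO (λ n → n + suc i) a))
        ≐ comp (fTerm (renO (λ n → n + suc i) b)) (av (r₁ i)))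
      ∷ conds (suc i) Ξ

    isCtxIso : Fm
    isCtxIso = foldr _∧'_ ⊤' (conds zero Δ)

-- Generalise from the copies Δ₁, Δ₂ to any two typed substitutions σ₁ σ₂ of a context Λ into a
-- context Θ, joined by arrows α V : σ₁ V → σ₂ V for the object variables V that are assumed (as
-- hypotheses) to be isomorphisms natural with respect to the arrow variables.  By induction on arrow
-- terms, every term t : A → B is then natural, σ₂ t ∘ α A = α B ∘ σ₁ t.  By induction on P one derives
-- P[σ₁] ⇔ P[σ₂]: an equation transports by conjugating with α and a chosen inverse, and under a
-- quantifier over an arrow g : A → B the data extend by letting g correspond to α B⁻¹ ∘ g ∘ α A (or
-- α B ∘ g ∘ α A⁻¹), which is natural because α B is invertible; object quantifiers extend by the
-- identity.  The theorem is the instance σᵢ : (Γ, Δ) → (Γ, Δᵢ), with α given by τ on Δ and by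
-- identities on Γ.

module Submission where

open import Defs
open import Data.List using (List; []; _∷_; _++_; map; foldr; length)
open import Data.List.Properties using (++-assoc)
open import Data.List.Membership.Propositional using (_∈_)
open import Data.List.Membership.Propositional.Properties using (∈-map⁺)
open import Data.List.Relation.Binary.Subset.Propositional using (_⊆_)
import Data.List.Relation.Unary.Any as Any
open import Data.Nat using (ℕ; zero; suc; _+_; _<ᵇ_; _≡ᵇ_; _<_; _≤_; s≤s; z≤n)
open import Data.Nat.Properties
  using (+-suc; +-comm; +-assoc; +-identityʳ; <-≤-trans; <-irrefl; m≤m+n; <ᵇ⇒<; <⇒<ᵇ; ≡ᵇ⇒≡; ≡⇒≡ᵇ; ≮⇒≥)
open import Data.Bool using (true; false; T)
open import Data.Bool.Properties using (T-≡)
open import Function.Bundles using (Equivalence)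
open import Data.Maybe using (just; nothing; maybe)
open import Data.Product using (_×_; _,_; proj₁; proj₂; Σ)
open import Data.Empty using (⊥; ⊥-elim)
open import Data.Unit using (tt)
open import Relation.Binary.PropositionalEquality using (_≡_; refl; sym; trans; cong; cong₂; subst)

first∈ : ∀ {A : Set} {x : A} {xs} → x ∈ x ∷ xs
first∈ = Any.here refl

second∈ : ∀ {A : Set} {x y : A} {xs} → x ∈ y ∷ x ∷ xs
second∈ = Any.there first∈

module Substitution (S : Signature) where
  open Lang S
  open Sub

  record _≈ˢ_ (σ τ : Sub) : Set where
    constructor mk≈ˢ
    field
      ≈ˢ-obj : ∀ n → so σ n ≡ so τ n
      ≈ˢ-arr : ∀ n → sa σ n ≡ sa τ n
  open _≈ˢ_ public

  liftS-cong : ∀ {σ τ} → σ ≈ˢ τ → liftS σ ≈ˢ liftS τ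
  liftS-cong p = mk≈ˢ (λ { zero → refl ; (suc n) → cong (renO suc) (≈ˢ-obj p n) })
                 (λ { zero → refl ; (suc n) → cong (renA suc) (≈ˢ-arr p n) })

  subO-cong : ∀ {σ τ} → σ ≈ˢ τ → ∀ t → subO σ t ≡ subO τ t
  subO-cong p (oc c) = refl
  subO-cong p (ov n) = ≈ˢ-obj p n

  subA-cong : ∀ {σ τ} → σ ≈ˢ τ → ∀ t → subA σ t ≡ subA τ t
  subA-cong p (ac f) = refl
  subA-cong p (av n) = ≈ˢ-arr p n
  subA-cong p (idt a) = cong idt (subO-cong p a)
  subA-cong p (comp g f) = cong₂ comp (subA-cong p g) (subA-cong p f)

  subE-cong : ∀ {σ τ} → σ ≈ˢ τ → ∀ e → subE σ e ≡ subE τ e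
  subE-cong p obj = refl
  subE-cong p (arr a b) = cong₂ arr (subO-cong p a) (subO-cong p b)

  subF-cong : ∀ {σ τ} → σ ≈ˢ τ → ∀ φ → subF σ φ ≡ subF τ φ
  subF-cong p (f ≐ g) = cong₂ _≐_ (subA-cong p f) (subA-cong p g)
  subF-cong p ⊤' = refl
  subF-cong p ⊥' = refl
  subF-cong p (φ ∧' ψ) = cong₂ _∧'_ (subF-cong p φ) (subF-cong p ψ)
  subF-cong p (φ ∨' ψ) = cong₂ _∨'_ (subF-cong p φ) (subF-cong p ψ)
  subF-cong p (φ ⇒' ψ) = cong₂ _⇒'_ (subF-cong p φ) (subF-cong p ψ)
  subF-cong p (∀' e φ) = cong₂ ∀' (subE-cong p e) (subF-cong (liftS-cong p) φ)
  subF-cong p (∃' e φ) = cong₂ ∃' (subE-cong p e) (subF-cong (liftS-cong p) φ)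

  infixl 9 _⊙_
  _⊙_ : Sub → Sub → Sub
  so (σ ⊙ τ) n = subO σ (so τ n)
  sa (σ ⊙ τ) n = subA σ (sa τ n)

  subO-⊙ : ∀ σ τ t → subO σ (subO τ t) ≡ subO (σ ⊙ τ) t
  subO-⊙ σ τ (oc c) = refl
  subO-⊙ σ τ (ov n) = refl

  subA-⊙ : ∀ σ τ t → subA σ (subA τ t) ≡ subA (σ ⊙ τ) t
  subA-⊙ σ τ (ac f) = refl
  subA-⊙ σ τ (av n) = refl
  subA-⊙ σ τ (idt a) = cong idt (subO-⊙ σ τ a)
  subA-⊙ σ τ (comp g f) = cong₂ comp (subA-⊙ σ τ g) (subA-⊙ σ τ f)

  subE-⊙ : ∀ σ τ e → subE σ (subE τ e) ≡ subE (σ ⊙ τ) e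
  subE-⊙ σ τ obj = refl
  subE-⊙ σ τ (arr a b) = cong₂ arr (subO-⊙ σ τ a) (subO-⊙ σ τ b)

  subO-liftS-wk : ∀ σ t → subO (liftS σ) (renO suc t) ≡ renO suc (subO σ t)
  subO-liftS-wk σ (oc c) = refl
  subO-liftS-wk σ (ov n) = refl

  subA-liftS-wk : ∀ σ t → subA (liftS σ) (renA suc t) ≡ renA suc (subA σ t)
  subA-liftS-wk σ (ac f) = refl
  subA-liftS-wk σ (av n) = refl
  subA-liftS-wk σ (idt a) = cong idt (subO-liftS-wk σ a)
  subA-liftS-wk σ (comp g f) = cong₂ comp (subA-liftS-wk σ g) (subA-liftS-wk σ f)

  liftS-⊙ : ∀ σ τ → liftS (σ ⊙ τ) ≈ˢ (liftS σ ⊙ liftS τ)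
  liftS-⊙ σ τ = mk≈ˢ (λ { zero → refl ; (suc n) → sym (subO-liftS-wk σ (so τ n)) })
                   (λ { zero → refl ; (suc n) → sym (subA-liftS-wk σ (sa τ n)) })

  subF-⊙ : ∀ σ τ φ → subF σ (subF τ φ) ≡ subF (σ ⊙ τ) φ
  subF-⊙ σ τ (f ≐ g) = cong₂ _≐_ (subA-⊙ σ τ f) (subA-⊙ σ τ g)
  subF-⊙ σ τ ⊤' = refl
  subF-⊙ σ τ ⊥' = refl
  subF-⊙ σ τ (φ ∧' ψ) = cong₂ _∧'_ (subF-⊙ σ τ φ) (subF-⊙ σ τ ψ)
  subF-⊙ σ τ (φ ∨' ψ) = cong₂ _∨'_ (subF-⊙ σ τ φ) (subF-⊙ σ τ ψ)
  subF-⊙ σ τ (φ ⇒' ψ) = cong₂ _⇒'_ (subF-⊙ σ τ φ) (subF-⊙ σ τ ψ)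
  subF-⊙ σ τ (∀' e φ) = cong₂ ∀' (subE-⊙ σ τ e)
    (trans (subF-⊙ (liftS σ) (liftS τ) φ) (sym (subF-cong (liftS-⊙ σ τ) φ)))
  subF-⊙ σ τ (∃' e φ) = cong₂ ∃' (subE-⊙ σ τ e)
    (trans (subF-⊙ (liftS σ) (liftS τ) φ) (sym (subF-cong (liftS-⊙ σ τ) φ)))

  renSub : Ren → Sub
  so (renSub ρ) n = ov (ρ n)
  sa (renSub ρ) n = av (ρ n)

  renO≡subO : ∀ ρ t → renO ρ t ≡ subO (renSub ρ) t
  renO≡subO ρ (oc c) = refl
  renO≡subO ρ (ov n) = refl

  renA≡subA : ∀ ρ t → renA ρ t ≡ subA (renSub ρ) t
  renA≡subA ρ (ac f) = refl
  renA≡subA ρ (av n) = refl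
  renA≡subA ρ (idt a) = cong idt (renO≡subO ρ a)
  renA≡subA ρ (comp g f) = cong₂ comp (renA≡subA ρ g) (renA≡subA ρ f)

  renE≡subE : ∀ ρ e → renE ρ e ≡ subE (renSub ρ) e
  renE≡subE ρ obj = refl
  renE≡subE ρ (arr a b) = cong₂ arr (renO≡subO ρ a) (renO≡subO ρ b)

  liftS-renSub : ∀ ρ → liftS (renSub ρ) ≈ˢ renSub (liftR ρ)
  liftS-renSub ρ = mk≈ˢ (λ { zero → refl ; (suc n) → refl }) (λ { zero → refl ; (suc n) → refl })

  renF≡subF : ∀ ρ φ → renF ρ φ ≡ subF (renSub ρ) φ
  renF≡subF ρ (f ≐ g) = cong₂ _≐_ (renA≡subA ρ f) (renA≡subA ρ g)
  renF≡subF ρ ⊤' = refl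
  renF≡subF ρ ⊥' = refl
  renF≡subF ρ (φ ∧' ψ) = cong₂ _∧'_ (renF≡subF ρ φ) (renF≡subF ρ ψ)
  renF≡subF ρ (φ ∨' ψ) = cong₂ _∨'_ (renF≡subF ρ φ) (renF≡subF ρ ψ)
  renF≡subF ρ (φ ⇒' ψ) = cong₂ _⇒'_ (renF≡subF ρ φ) (renF≡subF ρ ψ)
  renF≡subF ρ (∀' e φ) = cong₂ ∀' (renE≡subE ρ e)
    (trans (renF≡subF (liftR ρ) φ) (sym (subF-cong (liftS-renSub ρ) φ)))
  renF≡subF ρ (∃' e φ) = cong₂ ∃' (renE≡subE ρ e)
    (trans (renF≡subF (liftR ρ) φ) (sym (subF-cong (liftS-renSub ρ) φ)))

  wkSub : Sub → Sub
  so (wkSub σ) n = renO suc (so σ n)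
  sa (wkSub σ) n = renA suc (sa σ n)

  wkF-subF : ∀ σ φ → wkF (subF σ φ) ≡ subF (wkSub σ) φ
  wkF-subF σ φ = trans (renF≡subF suc (subF σ φ)) (trans (subF-⊙ (renSub suc) σ φ)
     (subF-cong (mk≈ˢ (λ n → sym (renO≡subO suc (so σ n))) (λ n → sym (renA≡subA suc (sa σ n)))) φ))

  consSub : ObT → ArT → Sub → Sub
  so (consSub t u σ) zero = t
  so (consSub t u σ) (suc n) = so σ n
  sa (consSub t u σ) zero = u
  sa (consSub t u σ) (suc n) = sa σ n

  liftS≈consSub : ∀ σ → liftS σ ≈ˢ consSub (ov zero) (av zero) (wkSub σ)
  liftS≈consSub σ = mk≈ˢ (λ { zero → refl ; (suc n) → refl }) (λ { zero → refl ; (suc n) → refl })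

  subO-wkSub : ∀ σ a → subO (wkSub σ) a ≡ renO suc (subO σ a)
  subO-wkSub σ (oc c) = refl
  subO-wkSub σ (ov n) = refl

  subO-consSub-wk : ∀ t u τ a → subO (consSub t u τ) (renO suc a) ≡ subO τ a
  subO-consSub-wk t u τ (oc c) = refl
  subO-consSub-wk t u τ (ov n) = refl

  module HeadSubstitution (s : Sub) (so-suc : ∀ m → so s (suc m) ≡ ov m) (sa-suc : ∀ m → sa s (suc m) ≡ av m) where
    subO-head-wk : ∀ x → subO s (subO (renSub (liftR suc)) (renO suc x)) ≡ renO suc x
    subO-head-wk (oc c) = refl
    subO-head-wk (ov j) = so-suc (suc j)

    subA-head-wk : ∀ x → subA s (subA (renSub (liftR suc)) (renA suc x)) ≡ renA suc x
    subA-head-wk (ac f) = refl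
    subA-head-wk (av j) = sa-suc (suc j)
    subA-head-wk (idt a) = cong idt (subO-head-wk a)
    subA-head-wk (comp g f) = cong₂ comp (subA-head-wk g) (subA-head-wk f)

    subF-head-liftS : ∀ σ φ → subF s (renF (liftR suc) (subF (liftS σ) φ))
                   ≡ subF (consSub (so s zero) (sa s zero) (wkSub σ)) φ
    subF-head-liftS σ φ = trans (cong (subF s) (trans (renF≡subF (liftR suc) _) (subF-⊙ _ _ φ)))
              (trans (subF-⊙ s _ φ) (subF-cong (mk≈ˢ
                (λ { zero → refl ; (suc n) → subO-head-wk (so σ n) })
                (λ { zero → refl ; (suc n) → subA-head-wk (sa σ n) })) φ))

  subF-sub0O-liftS : ∀ t σ φ → subF (sub0O t) (renF (liftR suc) (subF (liftS σ) φ))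
                   ≡ subF (consSub t (av zero) (wkSub σ)) φ
  subF-sub0O-liftS t = HeadSubstitution.subF-head-liftS (sub0O t) (λ m → refl) (λ m → refl)

  subF-sub0A-liftS : ∀ u σ φ → subF (sub0A u) (renF (liftR suc) (subF (liftS σ) φ))
                   ≡ subF (consSub (ov zero) u (wkSub σ)) φ
  subF-sub0A-liftS u = HeadSubstitution.subF-head-liftS (sub0A u) (λ m → refl) (λ m → refl)

  subF-liftS≡consSub : ∀ σ φ → subF (liftS σ) φ ≡ subF (consSub (ov zero) (av zero) (wkSub σ)) φ
  subF-liftS≡consSub σ φ = subF-cong (liftS≈consSub σ) φ

module Typing (S : Signature) where
  open Lang S
  open Sub
  open Substitution S

  wk-⊢o : ∀ {Γ e t} → Γ ⊢o t → (e ∷ Γ) ⊢o renO suc t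
  wk-⊢o (oc c) = oc c
  wk-⊢o (ov p) = ov (there p)

  wk-⊢a : ∀ {Γ e f a b} → Γ ⊢a f ∶ a ⇒ b → (e ∷ Γ) ⊢a renA suc f ∶ renO suc a ⇒ renO suc b
  wk-⊢a (ac f) = ac f
  wk-⊢a (av p) = av (there p)
  wk-⊢a (idt o) = idt (wk-⊢o o)
  wk-⊢a (comp g f) = comp (wk-⊢a g) (wk-⊢a f)

  cast-⊢a : ∀ {Γ f a b a' b'} → a ≡ a' → b ≡ b' → Γ ⊢a f ∶ a ⇒ b → Γ ⊢a f ∶ a' ⇒ b'
  cast-⊢a refl refl d = d

  TypedAt : Ctx → Sub → ℕ → Entry → Set
  TypedAt Δ σ n obj = Δ ⊢o so σ n
  TypedAt Δ σ n (arr a b) = Δ ⊢a sa σ n ∶ subO σ a ⇒ subO σ b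

  TypedSub : Ctx → Ctx → Sub → Set
  TypedSub Γ Δ σ = ∀ {n e} → Γ ∋ n ∶ e → TypedAt Δ σ n e

  subO-⊢o : ∀ {Γ Δ σ t} → TypedSub Γ Δ σ → Γ ⊢o t → Δ ⊢o subO σ t
  subO-⊢o ts (oc c) = oc c
  subO-⊢o ts (ov p) = ts p

  subA-⊢a : ∀ {Γ Δ σ f a b} → TypedSub Γ Δ σ → Γ ⊢a f ∶ a ⇒ b → Δ ⊢a subA σ f ∶ subO σ a ⇒ subO σ b
  subA-⊢a ts (ac f) = ac f
  subA-⊢a ts (av p) = ts p
  subA-⊢a ts (idt o) = idt (subO-⊢o ts o)
  subA-⊢a ts (comp g f) = comp (subA-⊢a ts g) (subA-⊢a ts f)

  subE-⊢e : ∀ {Γ Δ σ e} → TypedSub Γ Δ σ → Γ ⊢e e → Δ ⊢e subE σ e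
  subE-⊢e ts obj = obj
  subE-⊢e ts (arr a b) = arr (subO-⊢o ts a) (subO-⊢o ts b)

  liftS-typed : ∀ {Γ Δ σ e} → TypedSub Γ Δ σ → TypedSub (e ∷ Γ) (subE σ e ∷ Δ) (liftS σ)
  liftS-typed {e = obj} ts here = ov here
  liftS-typed {σ = σ} {e = arr a b} ts here =
    cast-⊢a (sym (subO-liftS-wk σ a)) (sym (subO-liftS-wk σ b)) (av here)
  liftS-typed ts (there {e = obj} p) = wk-⊢o (ts p)
  liftS-typed {σ = σ} ts (there {e = arr a b} p) =
    cast-⊢a (sym (subO-liftS-wk σ a)) (sym (subO-liftS-wk σ b)) (wk-⊢a (ts p))

  subF-⊢f : ∀ {Γ Δ σ φ} → TypedSub Γ Δ σ → Γ ⊢f φ → Δ ⊢f subF σ φ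
  subF-⊢f ts (eq f g) = eq (subA-⊢a ts f) (subA-⊢a ts g)
  subF-⊢f ts top = top
  subF-⊢f ts bot = bot
  subF-⊢f ts (and p q) = and (subF-⊢f ts p) (subF-⊢f ts q)
  subF-⊢f ts (or p q) = or (subF-⊢f ts p) (subF-⊢f ts q)
  subF-⊢f ts (imp p q) = imp (subF-⊢f ts p) (subF-⊢f ts q)
  subF-⊢f ts (all e p) = all (subE-⊢e ts e) (subF-⊢f (liftS-typed ts) p)
  subF-⊢f ts (ex e p) = ex (subE-⊢e ts e) (subF-⊢f (liftS-typed ts) p)

  wkSub-typed : ∀ {Λ Θ σ e'} → TypedSub Λ Θ σ → TypedSub Λ (e' ∷ Θ) (wkSub σ)
  wkSub-typed ts {e = obj} p = wk-⊢o (ts p)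
  wkSub-typed {σ = σ} ts {e = arr a b} p = cast-⊢a (sym (subO-wkSub σ a)) (sym (subO-wkSub σ b)) (wk-⊢a (ts p))

  HeadTyped : Ctx → Sub → Entry → ObT → ArT → Set
  HeadTyped Θ σ obj       t u = Θ ⊢o t
  HeadTyped Θ σ (arr a b) t u = Θ ⊢a u ∶ renO suc (subO σ a) ⇒ renO suc (subO σ b)

  consSub-typed : ∀ {Λ Θ σ e e' t u} → TypedSub Λ Θ σ → HeadTyped (e' ∷ Θ) σ e t u →
                  TypedSub (e ∷ Λ) (e' ∷ Θ) (consSub t u (wkSub σ))
  consSub-typed ts h (here {e = obj}) = h
  consSub-typed {σ = σ} {t = t} {u} ts h (here {e = arr a b}) =
    cast-⊢a (sym (trans (subO-consSub-wk t u (wkSub σ) a) (subO-wkSub σ a)))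
            (sym (trans (subO-consSub-wk t u (wkSub σ) b) (subO-wkSub σ b))) h
  consSub-typed ts h (there {e = obj} p) = wkSub-typed ts p
  consSub-typed {σ = σ} {t = t} {u} ts h (there {e = arr a b} p) =
    cast-⊢a (sym (subO-consSub-wk t u (wkSub σ) a)) (sym (subO-consSub-wk t u (wkSub σ) b)) (wkSub-typed ts p)

  TypedRen : Ctx → Ctx → Ren → Set
  TypedRen Γ Δ ρ = ∀ {n e} → Γ ∋ n ∶ e → Δ ∋ ρ n ∶ renE ρ e

  renSub-typed : ∀ {Γ Δ ρ} → TypedRen Γ Δ ρ → TypedSub Γ Δ (renSub ρ)
  renSub-typed tρ {e = obj} p = ov (tρ p)
  renSub-typed {ρ = ρ} tρ {e = arr a b} p = cast-⊢a (renO≡subO ρ a) (renO≡subO ρ b) (av (tρ p))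

  wkF-⊢f : ∀ {Γ e φ} → Γ ⊢f φ → (e ∷ Γ) ⊢f wkF φ
  wkF-⊢f {φ = φ} p = subst (λ x → _ ⊢f x) (sym (renF≡subF suc φ)) (subF-⊢f (renSub-typed there) p)

  wk-⊢e : ∀ {Γ e e'} → Γ ⊢e e' → (e ∷ Γ) ⊢e renE suc e'
  wk-⊢e obj = obj
  wk-⊢e (arr a b) = arr (wk-⊢o a) (wk-⊢o b)

  lookup-⊢e : ∀ {Γ n e} → ⊢ctx Γ → Γ ∋ n ∶ e → Γ ⊢e e
  lookup-⊢e (w ∷ c) here = wk-⊢e w
  lookup-⊢e (w ∷ c) (there p) = wk-⊢e (lookup-⊢e c p)

  arr-⊢o : ∀ {Θ a b} → Θ ⊢e arr a b → (Θ ⊢o a) × (Θ ⊢o b)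
  arr-⊢o (arr x y) = x , y

  endpoints-⊢o : ∀ {Γ f a b} → ⊢ctx Γ → Γ ⊢a f ∶ a ⇒ b → (Γ ⊢o a) × (Γ ⊢o b)
  endpoints-⊢o c (ac f) = oc _ , oc _
  endpoints-⊢o c (av p) with lookup-⊢e c p
  ... | arr x y = x , y
  endpoints-⊢o c (idt o) = o , o
  endpoints-⊢o c (comp g f) = proj₁ (endpoints-⊢o c f) , proj₂ (endpoints-⊢o c g)

module Renaming (S : Signature) where
  open Lang S
  open Substitution S
  open Typing S

  renO-ext : ∀ {ρ ρ'} → (∀ n → ρ n ≡ ρ' n) → ∀ a → renO ρ a ≡ renO ρ' a
  renO-ext h (oc c) = refl
  renO-ext h (ov n) = cong ov (h n)

  renE-ext : ∀ {ρ ρ'} → (∀ n → ρ n ≡ ρ' n) → ∀ e → renE ρ e ≡ renE ρ' e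
  renE-ext h obj = refl
  renE-ext h (arr a b) = cong₂ arr (renO-ext h a) (renO-ext h b)

  renO-∘ : ∀ ρ ρ' a → renO ρ (renO ρ' a) ≡ renO (λ n → ρ (ρ' n)) a
  renO-∘ ρ ρ' (oc c) = refl
  renO-∘ ρ ρ' (ov n) = refl

  renE-∘ : ∀ ρ ρ' e → renE ρ (renE ρ' e) ≡ renE (λ n → ρ (ρ' n)) e
  renE-∘ ρ ρ' obj = refl
  renE-∘ ρ ρ' (arr a b) = cong₂ arr (renO-∘ ρ ρ' a) (renO-∘ ρ ρ' b)

  renO-id : ∀ a → renO (λ n → n) a ≡ a
  renO-id (oc c) = refl
  renO-id (ov n) = refl

  renE-id : ∀ e → renE (λ n → n) e ≡ e
  renE-id obj = refl
  renE-id (arr a b) = cong₂ arr (renO-id a) (renO-id b)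

  cast-∋ : ∀ {Γ n n' e e'} → n ≡ n' → e ≡ e' → Γ ∋ n ∶ e → Γ ∋ n' ∶ e'
  cast-∋ refl refl p = p

  typedRen-ext : ∀ {Γ Δ ρ ρ'} → TypedRen Γ Δ ρ → (∀ n → ρ n ≡ ρ' n) → TypedRen Γ Δ ρ'
  typedRen-ext {ρ = ρ} {ρ'} tρ h {n} {e} p = cast-∋ (h n) (renE-ext h e) (tρ p)

  typedRen-∘ : ∀ {Γ Δ Ε ρ ρ'} → TypedRen Γ Δ ρ → TypedRen Δ Ε ρ' → TypedRen Γ Ε (λ n → ρ' (ρ n))
  typedRen-∘ {ρ = ρ} {ρ'} tρ tρ' {e = e} p = cast-∋ refl (renE-∘ ρ' ρ e) (tρ' (tρ p))

  typedRen-liftR : ∀ {Γ Δ ρ e} → TypedRen Γ Δ ρ → TypedRen (e ∷ Γ) (renE ρ e ∷ Δ) (liftR ρ)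
  typedRen-liftR {ρ = ρ} tρ (here {e = e}) =
    cast-∋ refl (trans (renE-∘ suc ρ e) (sym (renE-∘ (liftR ρ) suc e))) here
  typedRen-liftR {ρ = ρ} tρ (there {e = e} p) =
    cast-∋ refl (trans (renE-∘ suc ρ e) (sym (renE-∘ (liftR ρ) suc e))) (there (tρ p))

  typedRen-shift : ∀ Ξ {Γ} → TypedRen Γ (Ξ ++ Γ) (λ n → length Ξ + n)
  typedRen-shift [] {e = e} p = cast-∋ refl (sym (renE-id e)) p
  typedRen-shift (x ∷ Ξ) {e = e} p = cast-∋ refl (renE-∘ suc (λ n → length Ξ + n) e) (there (typedRen-shift Ξ p))

  renE-⊢e : ∀ {Γ Δ ρ e} → TypedRen Γ Δ ρ → Γ ⊢e e → Δ ⊢e renE ρ e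
  renE-⊢e {ρ = ρ} {e} tρ w = subst (_ ⊢e_) (sym (renE≡subE ρ e)) (subE-⊢e (renSub-typed tρ) w)

module Derivations (S : Signature) (T : Lang.Theory S) where
  open Lang S
  open Theory T
  open Substitution S
  open Typing S

  sub0O-wkO : ∀ Y X → subO (sub0O Y) (renO suc X) ≡ X
  sub0O-wkO Y (oc c) = refl
  sub0O-wkO Y (ov n) = refl

  sub0A-wkO : ∀ u X → subO (sub0A u) (renO suc X) ≡ X
  sub0A-wkO u (oc c) = refl
  sub0A-wkO u (ov n) = refl

  sub0A-wkA : ∀ u f → subA (sub0A u) (renA suc f) ≡ f
  sub0A-wkA u (ac f) = refl
  sub0A-wkA u (av n) = refl
  sub0A-wkA u (idt a) = cong idt (sub0A-wkO u a)
  sub0A-wkA u (comp g f) = cong₂ comp (sub0A-wkA u g) (sub0A-wkA u f)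

  -- Instantiating a closed axiom leaves the endpoints of an instance under a stack of weakenings and
  -- single substitutions that is definitionally the identity on atoms only.
  fixesAtoms⇒id : (F : ObT → ObT) → (∀ c → F (oc c) ≡ oc c) → (∀ n → F (ov n) ≡ ov n) → ∀ X → X ≡ F X
  fixesAtoms⇒id F fix-oc fix-ov (oc c) = sym (fix-oc c)
  fixesAtoms⇒id F fix-oc fix-ov (ov n) = sym (fix-ov n)

  cong₃ : ∀ {A B C D : Set} (f : A → B → C → D) {x x' y y' z z'} → x ≡ x' → y ≡ y' → z ≡ z' → f x y z ≡ f x' y' z'
  cong₃ f refl refl refl = refl

  cast⊢ : ∀ {Γ Φ φ ψ} → φ ≡ ψ → T ▸ Γ ∣ Φ ⊢ φ → T ▸ Γ ∣ Φ ⊢ ψ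
  cast⊢ refl d = d

  ∀*-intro : ∀ Ξ {Γ φ} → ⊢ctx (Ξ ++ Γ) → T ▸ Ξ ++ Γ ∣ [] ⊢ φ → T ▸ Γ ∣ [] ⊢ ∀* Ξ φ
  ∀*-intro []      c       d = d
  ∀*-intro (e ∷ Ξ) (w ∷ c) d = ∀*-intro Ξ c (∀I w d)

  module Equational {Θ : Ctx} (⊢Θ : ⊢ctx Θ) {Φ : List Fm} where
    Derives : Fm → Set
    Derives ψ = T ▸ Θ ∣ Φ ⊢ ψ

    dom-⊢o : ∀ {f a b} → Θ ⊢a f ∶ a ⇒ b → Θ ⊢o a
    dom-⊢o t = proj₁ (endpoints-⊢o ⊢Θ t)
    cod-⊢o : ∀ {f a b} → Θ ⊢a f ∶ a ⇒ b → Θ ⊢o b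
    cod-⊢o t = proj₂ (endpoints-⊢o ⊢Θ t)

    ↑ : ObT → ObT
    ↑ = renO suc

    ≐-refl : ∀ {f a b} → Θ ⊢a f ∶ a ⇒ b → Derives (f ≐ f)
    ≐-refl {f} {a} {b} t =
      ∀Ea (∀Eo (∀Eo (ax (Ax-cat refl')) (dom-⊢o t)) (cod-⊢o t)) (cast-⊢a (sym (sub0O-wkO b a)) refl t)

    ≐-sym : ∀ {f g a b} → Θ ⊢a f ∶ a ⇒ b → Θ ⊢a g ∶ a ⇒ b → Derives (f ≐ g) → Derives (g ≐ f)
    ≐-sym {f} {g} {a} {b} tf tg d = ⇒E (cast⊢ (cong₂ (λ x y → (x ≐ g) ⇒' (g ≐ y)) (sub0A-wkA g f) (sub0A-wkA g f))
        (∀Ea (∀Ea (∀Eo (∀Eo (ax (Ax-cat sym')) (dom-⊢o tf)) (cod-⊢o tf)) tf′) tg′)) d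
      where
        tf′ = cast-⊢a (sym (sub0O-wkO b a)) refl tf
        tg′ = cast-⊢a (fixesAtoms⇒id (λ X → subO (sub0A f) (subO (liftS (sub0O b)) (↑ (↑ X)))) (λ _ → refl) (λ _ → refl) a)
                      (fixesAtoms⇒id (λ X → subO (sub0A f) (↑ X)) (λ _ → refl) (λ _ → refl) b) tg

    ≐-trans : ∀ {f g h a b} → Θ ⊢a f ∶ a ⇒ b → Θ ⊢a g ∶ a ⇒ b → Θ ⊢a h ∶ a ⇒ b →
              Derives (f ≐ g) → Derives (g ≐ h) → Derives (f ≐ h)
    ≐-trans {f} {g} {h} {a} {b} tf tg th d e = ⇒E (⇒E (cast⊢ axiomInstance≡
        (∀Ea (∀Ea (∀Ea (∀Eo (∀Eo (ax (Ax-cat trans')) (dom-⊢o tf)) (cod-⊢o tf)) tf′) tg′) th′)) d) e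
      where
        axiomInstance≡ = cong₂ (λ x y → (x ≐ y) ⇒' (y ≐ h) ⇒' (x ≐ h))
          (trans (cong (subA (sub0A h)) (subA-liftS-wk (sub0A g) (renA suc f))) (trans (sub0A-wkA h _) (sub0A-wkA g f)))
          (sub0A-wkA h g)
        tf′ = cast-⊢a (sym (sub0O-wkO b a)) refl tf
        tg′ = cast-⊢a (fixesAtoms⇒id (λ X → subO (sub0A f) (subO (liftS (sub0O b)) (↑ (↑ X)))) (λ _ → refl) (λ _ → refl) a)
                      (fixesAtoms⇒id (λ X → subO (sub0A f) (↑ X)) (λ _ → refl) (λ _ → refl) b) tg
        th′ = cast-⊢a (fixesAtoms⇒id (λ X → subO (sub0A g) (subO (liftS (sub0A f)) (subO (liftS (liftS (sub0O b))) (↑ (↑ (↑ X))))))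
                                    (λ _ → refl) (λ _ → refl) a)
                      (fixesAtoms⇒id (λ X → subO (sub0A g) (subO (liftS (sub0A f)) (↑ (↑ X)))) (λ _ → refl) (λ _ → refl) b) th

    sub0A-wkA² : ∀ u t → subA (liftS (sub0A u)) (renA suc (renA suc t)) ≡ renA suc t
    sub0A-wkA² u t = trans (subA-liftS-wk (sub0A u) (renA suc t)) (cong (renA suc) (sub0A-wkA u t))

    sub0A-wkA³ : ∀ u t → subA (liftS (liftS (sub0A u))) (renA suc (renA suc (renA suc t))) ≡ renA suc (renA suc t)
    sub0A-wkA³ u t = trans (subA-liftS-wk (liftS (sub0A u)) (renA suc (renA suc t))) (cong (renA suc) (sub0A-wkA² u t))

    ∘-cong : ∀ {f f' g g' a b c} → Θ ⊢a f ∶ a ⇒ b → Θ ⊢a f' ∶ a ⇒ b → Θ ⊢a g ∶ b ⇒ c → Θ ⊢a g' ∶ b ⇒ c →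
             Derives (f ≐ f') → Derives (g ≐ g') → Derives (comp g f ≐ comp g' f')
    ∘-cong {f} {f'} {g} {g'} {a} {b} {c} tf tf' tg tg' d e = ⇒E (⇒E (cast⊢ axiomInstance≡
        (∀Ea (∀Ea (∀Ea (∀Ea (∀Eo (∀Eo (∀Eo (ax (Ax-cat cong∘)) (dom-⊢o tf)) (cod-⊢o tf)) (cod-⊢o tg))
          tf″) tf‴) tg″) tg‴)) d) e
      where
        axiomInstance≡ = cong₃ (λ x y z → (x ≐ y) ⇒' (z ≐ g') ⇒' (comp z x ≐ comp g' y))
          (trans (cong (λ z → subA (sub0A g') (subA (liftS (sub0A g)) z)) (sub0A-wkA³ f' f))
            (trans (cong (subA (sub0A g')) (sub0A-wkA² g f)) (sub0A-wkA g' f)))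
          (trans (cong (subA (sub0A g')) (sub0A-wkA² g f')) (sub0A-wkA g' f'))
          (sub0A-wkA g' g)
        tf″ = cast-⊢a (fixesAtoms⇒id (λ X → subO (sub0O c) (subO (liftS (sub0O b)) (↑ (↑ X)))) (λ _ → refl) (λ _ → refl) a)
                      (fixesAtoms⇒id (λ X → subO (sub0O c) (↑ X)) (λ _ → refl) (λ _ → refl) b) tf
        tf‴ = cast-⊢a (fixesAtoms⇒id (λ X → subO (sub0A f) (subO (liftS (sub0O c)) (subO (liftS (liftS (sub0O b))) (↑ (↑ (↑ X))))))
                                    (λ _ → refl) (λ _ → refl) a)
                      (fixesAtoms⇒id (λ X → subO (sub0A f) (subO (liftS (sub0O c)) (↑ (↑ X)))) (λ _ → refl) (λ _ → refl) b) tf'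
        tg″ = cast-⊢a (fixesAtoms⇒id (λ X → subO (sub0A f') (subO (liftS (sub0A f)) (subO (liftS (liftS (sub0O c))) (↑ (↑ (↑ X))))))
                                    (λ _ → refl) (λ _ → refl) b)
                      (fixesAtoms⇒id (λ X → subO (sub0A f') (subO (liftS (sub0A f)) (↑ (↑ X)))) (λ _ → refl) (λ _ → refl) c) tg
        tg‴ = cast-⊢a (fixesAtoms⇒id (λ X → subO (sub0A g) (subO (liftS (sub0A f')) (subO (liftS (liftS (sub0A f)))
                                                 (subO (liftS (liftS (liftS (sub0O c)))) (↑ (↑ (↑ (↑ X))))))))
                                    (λ _ → refl) (λ _ → refl) b)
                      (fixesAtoms⇒id (λ X → subO (sub0A g) (subO (liftS (sub0A f')) (subO (liftS (liftS (sub0A f))) (↑ (↑ (↑ X))))))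
                                    (λ _ → refl) (λ _ → refl) c) tg'

    identityˡ : ∀ {f a b} → Θ ⊢a f ∶ a ⇒ b → Derives (comp (idt b) f ≐ f)
    identityˡ {f} {a} {b} t =
      cast⊢ (cong (λ x → comp (idt x) f ≐ f) (sym (fixesAtoms⇒id (λ X → subO (sub0A f) (↑ X)) (λ _ → refl) (λ _ → refl) b)))
        (∀Ea (∀Eo (∀Eo (ax (Ax-cat idL)) (dom-⊢o t)) (cod-⊢o t)) (cast-⊢a (sym (sub0O-wkO b a)) refl t))

    identityʳ : ∀ {f a b} → Θ ⊢a f ∶ a ⇒ b → Derives (comp f (idt a) ≐ f)
    identityʳ {f} {a} {b} t =
      cast⊢ (cong (λ x → comp f (idt x) ≐ f)
                  (sym (fixesAtoms⇒id (λ X → subO (sub0A f) (subO (liftS (sub0O b)) (↑ (↑ X)))) (λ _ → refl) (λ _ → refl) a)))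
        (∀Ea (∀Eo (∀Eo (ax (Ax-cat idR)) (dom-⊢o t)) (cod-⊢o t)) (cast-⊢a (sym (sub0O-wkO b a)) refl t))

    ∘-assoc : ∀ {f g h a b c d} → Θ ⊢a f ∶ a ⇒ b → Θ ⊢a g ∶ b ⇒ c → Θ ⊢a h ∶ c ⇒ d →
              Derives (comp h (comp g f) ≐ comp (comp h g) f)
    ∘-assoc {f} {g} {h} {a} {b} {c} {d} tf tg th = cast⊢ axiomInstance≡
        (∀Ea (∀Ea (∀Ea (∀Eo (∀Eo (∀Eo (∀Eo (ax (Ax-cat assoc)) (dom-⊢o tf)) (cod-⊢o tf)) (cod-⊢o tg)) (cod-⊢o th))
          tf′) tg′) th′)
      where
        axiomInstance≡ = cong₂ (λ x y → comp h (comp y x) ≐ comp (comp h y) x)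
          (trans (cong (subA (sub0A h)) (sub0A-wkA² g f)) (sub0A-wkA h f)) (sub0A-wkA h g)
        tf′ = cast-⊢a (fixesAtoms⇒id (λ X → subO (sub0O d) (subO (liftS (sub0O c)) (subO (liftS (liftS (sub0O b))) (↑ (↑ (↑ X))))))
                                    (λ _ → refl) (λ _ → refl) a)
                      (fixesAtoms⇒id (λ X → subO (sub0O d) (subO (liftS (sub0O c)) (↑ (↑ X)))) (λ _ → refl) (λ _ → refl) b) tf
        tg′ = cast-⊢a (fixesAtoms⇒id (λ X → subO (sub0A f) (subO (liftS (sub0O d)) (subO (liftS (liftS (sub0O c))) (↑ (↑ (↑ X))))))
                                    (λ _ → refl) (λ _ → refl) b)
                      (fixesAtoms⇒id (λ X → subO (sub0A f) (subO (liftS (sub0O d)) (↑ (↑ X)))) (λ _ → refl) (λ _ → refl) c) tg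
        th′ = cast-⊢a (fixesAtoms⇒id (λ X → subO (sub0A g) (subO (liftS (sub0A f)) (subO (liftS (liftS (sub0O d))) (↑ (↑ (↑ X))))))
                                    (λ _ → refl) (λ _ → refl) c)
                      (fixesAtoms⇒id (λ X → subO (sub0A g) (subO (liftS (sub0A f)) (↑ (↑ X)))) (λ _ → refl) (λ _ → refl) d) th

    record Arrow (X Y : ObT) : Set where
      constructor _⦂_
      field
        term : ArT
        typing : Θ ⊢a term ∶ X ⇒ Y
    open Arrow public

    infixr 9 _∘ₜ_
    _∘ₜ_ : ∀ {X Y Z} → Arrow Y Z → Arrow X Y → Arrow X Z
    g ∘ₜ f = comp (term g) (term f) ⦂ comp (typing g) (typing f)

    idₜ : ∀ {X} → Θ ⊢o X → Arrow X X
    idₜ o = idt _ ⦂ idt o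

    _≐ₜ_ : ∀ {X Y} → Arrow X Y → Arrow X Y → Fm
    f ≐ₜ g = term f ≐ term g

    record Chain {X Y} (f g : Arrow X Y) : Set where
      constructor chain
      field derivation : Derives (f ≐ₜ g)

    infix  1 begin_
    infixr 2 _≐⟨_⟩_
    infix  3 _∎

    begin_ : ∀ {X Y} {f g : Arrow X Y} → Chain f g → Derives (f ≐ₜ g)
    begin chain d = d

    _≐⟨_⟩_ : ∀ {X Y} (f : Arrow X Y) {g h : Arrow X Y} → Derives (f ≐ₜ g) → Chain g h → Chain f h
    _≐⟨_⟩_ f {g} {h} d (chain e) = chain (≐-trans (typing f) (typing g) (typing h) d e)

    _∎ : ∀ {X Y} (f : Arrow X Y) → Chain f f
    f ∎ = chain (≐-refl (typing f))

    ≐-symₜ : ∀ {X Y} (f g : Arrow X Y) → Derives (f ≐ₜ g) → Derives (g ≐ₜ f)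
    ≐-symₜ f g = ≐-sym (typing f) (typing g)

    ∘-assocₜ : ∀ {A B C E} (h : Arrow C E) (g : Arrow B C) (f : Arrow A B) → Derives ((h ∘ₜ (g ∘ₜ f)) ≐ₜ ((h ∘ₜ g) ∘ₜ f))
    ∘-assocₜ h g f = ∘-assoc (typing f) (typing g) (typing h)

    ∘-assoc⁻ₜ : ∀ {A B C E} (h : Arrow C E) (g : Arrow B C) (f : Arrow A B) → Derives (((h ∘ₜ g) ∘ₜ f) ≐ₜ (h ∘ₜ (g ∘ₜ f)))
    ∘-assoc⁻ₜ h g f = ≐-symₜ (h ∘ₜ (g ∘ₜ f)) ((h ∘ₜ g) ∘ₜ f) (∘-assocₜ h g f)

    ∘-congˡ : ∀ {X Y Z} (h : Arrow Y Z) (f f' : Arrow X Y) → Derives (f ≐ₜ f') → Derives ((h ∘ₜ f) ≐ₜ (h ∘ₜ f'))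
    ∘-congˡ h f f' d = ∘-cong (typing f) (typing f') (typing h) (typing h) d (≐-refl (typing h))

    ∘-congʳ : ∀ {X Y Z} (g g' : Arrow Y Z) (f : Arrow X Y) → Derives (g ≐ₜ g') → Derives ((g ∘ₜ f) ≐ₜ (g' ∘ₜ f))
    ∘-congʳ g g' f d = ∘-cong (typing f) (typing f) (typing g) (typing g') (≐-refl (typing f)) d

    identityˡₜ : ∀ {X Y} (f : Arrow X Y) → Derives ((idₜ (cod-⊢o (typing f)) ∘ₜ f) ≐ₜ f)
    identityˡₜ f = identityˡ (typing f)

    identityʳₜ : ∀ {X Y} (f : Arrow X Y) → Derives ((f ∘ₜ idₜ (dom-⊢o (typing f))) ≐ₜ f)
    identityʳₜ f = identityʳ (typing f)

module GivenFacts (S : Signature) (T : Lang.Theory S) where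
  open Lang S
  open Typing S
  open Derivations S T

  data Conjunct (Φ : List Fm) : Fm → Set where
    member : ∀ {ψ} → ψ ∈ Φ → Conjunct Φ ψ
    conj₁ : ∀ {ψ χ} → Conjunct Φ (ψ ∧' χ) → Conjunct Φ ψ
    conj₂ : ∀ {ψ χ} → Conjunct Φ (ψ ∧' χ) → Conjunct Φ χ

  conjunct-⊢ : ∀ {Θ Φ ψ} → Conjunct Φ ψ → T ▸ Θ ∣ Φ ⊢ ψ
  conjunct-⊢ (member x) = hyp x
  conjunct-⊢ (conj₁ p) = ∧E₁ (conjunct-⊢ p)
  conjunct-⊢ (conj₂ p) = ∧E₂ (conjunct-⊢ p)

  conjunct-mono : ∀ {Φ Ψ ψ} → Φ ⊆ Ψ → Conjunct Φ ψ → Conjunct Ψ ψ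
  conjunct-mono i (member x) = member (i x)
  conjunct-mono i (conj₁ p) = conj₁ (conjunct-mono i p)
  conjunct-mono i (conj₂ p) = conj₂ (conjunct-mono i p)

  conjunct-wk : ∀ {Φ ψ} → Conjunct Φ ψ → Conjunct (map wkF Φ) (wkF ψ)
  conjunct-wk (member x) = member (∈-map⁺ wkF x)
  conjunct-wk (conj₁ p) = conj₁ (conjunct-wk p)
  conjunct-wk (conj₂ p) = conj₂ (conjunct-wk p)

  IsIso : ObT → ObT → ArT → Fm
  IsIso X Y a = ∃' (arr Y X) ((comp (av zero) (renA suc a) ≐ idt (renO suc X))
                         ∧' (comp (renA suc a) (av zero) ≐ idt (renO suc Y)))

  IsIso-⊢f : ∀ {Θ X Y a} → Θ ⊢o X → Θ ⊢o Y → Θ ⊢a a ∶ X ⇒ Y → Θ ⊢f IsIso X Y a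
  IsIso-⊢f x y t = ex (arr y x) (and (eq (comp (av here) (wk-⊢a t)) (idt (wk-⊢o x)))
                                     (eq (comp (wk-⊢a t) (av here)) (idt (wk-⊢o y))))

  -- On Γ the arrows α are identities, whose iso and naturality conditions hold outright rather than
  -- being among the hypotheses.
  data Given (Θ : Ctx) (Φ : List Fm) : Fm → Set where
    conjunct : ∀ {ψ} → Conjunct Φ ψ → Given Θ Φ ψ
    id-iso : ∀ {X} → Θ ⊢o X → Given Θ Φ (IsIso X X (idt X))
    id-natural : ∀ {g A B} → Θ ⊢a g ∶ A ⇒ B → Given Θ Φ (comp g (idt A) ≐ comp (idt B) g)

  renO-liftR-wk : ∀ a → renO (liftR suc) (renO suc a) ≡ renO suc (renO suc a)
  renO-liftR-wk (oc c) = refl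
  renO-liftR-wk (ov n) = refl

  renA-liftR-wk : ∀ a → renA (liftR suc) (renA suc a) ≡ renA suc (renA suc a)
  renA-liftR-wk (ac f) = refl
  renA-liftR-wk (av n) = refl
  renA-liftR-wk (idt a) = cong idt (renO-liftR-wk a)
  renA-liftR-wk (comp g f) = cong₂ comp (renA-liftR-wk g) (renA-liftR-wk f)

  wkF-IsIso : ∀ X Y a → wkF (IsIso X Y a) ≡ IsIso (renO suc X) (renO suc Y) (renA suc a)
  wkF-IsIso X Y a = cong₃ (λ x y z → ∃' (arr (renO suc Y) (renO suc X)) ((comp (av zero) x ≐ idt y) ∧' (comp x (av zero) ≐ idt z)))
    (renA-liftR-wk a) (renO-liftR-wk X) (renO-liftR-wk Y)

  given-mono : ∀ {Θ Φ Ψ ψ} → Φ ⊆ Ψ → Given Θ Φ ψ → Given Θ Ψ ψ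
  given-mono i (conjunct p) = conjunct (conjunct-mono i p)
  given-mono i (id-iso x) = id-iso x
  given-mono i (id-natural t) = id-natural t

  given-wk : ∀ {Θ Φ ψ e} → Given Θ Φ ψ → Given (e ∷ Θ) (map wkF Φ) (wkF ψ)
  given-wk (conjunct p) = conjunct (conjunct-wk p)
  given-wk (id-iso {X} x) = subst (Given _ _) (sym (wkF-IsIso X X (idt X))) (id-iso (wk-⊢o x))
  given-wk (id-natural t) = id-natural (wk-⊢a t)

  given-⊢ : ∀ {Θ Φ ψ} → ⊢ctx Θ → Given Θ Φ ψ → T ▸ Θ ∣ Φ ⊢ ψ
  given-⊢ c (conjunct p) = conjunct-⊢ p
  given-⊢ {Θ} {Φ} c (id-iso {X} x) = ∃Ia (arr x x)
      (and (eq (comp (av here) (idt (wk-⊢o x))) (idt (wk-⊢o x))) (eq (comp (idt (wk-⊢o x)) (av here)) (idt (wk-⊢o x))))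
      (idt x)
      (cast⊢ (cong (λ z → (comp (idt X) (idt z) ≐ idt z) ∧' (comp (idt z) (idt X) ≐ idt z)) (sym (sub0A-wkO (idt X) X)))
        (∧I (identityˡ (idt x)) (identityˡ (idt x))))
    where open Equational c {Φ}
  given-⊢ {Θ} {Φ} c (id-natural t) =
    ≐-trans (comp t (idt (dom-⊢o t))) t (comp (idt (cod-⊢o t)) t) (identityʳ t) (≐-sym (comp (idt (cod-⊢o t)) t) t (identityˡ t))
    where open Equational c {Φ}

module Transport (S : Signature) (T : Lang.Theory S) where
  open Lang S
  open Sub
  open Substitution S
  open Typing S
  open Derivations S T
  open GivenFacts S T

  component : (ℕ → ArT) → ObT → ArT
  component α (oc c) = idt (oc c)
  component α (ov j) = α j

  consComponent : ArT → (ℕ → ArT) → ℕ → ArT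
  consComponent a α zero = a
  consComponent a α (suc n) = renA suc (α n)

  component-wk : ∀ α a → component (λ n → renA suc (α n)) a ≡ renA suc (component α a)
  component-wk α (oc c) = refl
  component-wk α (ov n) = refl

  component-consComponent-wk : ∀ a₀ α a → component (consComponent a₀ α) (renO suc a) ≡ renA suc (component α a)
  component-consComponent-wk a₀ α (oc c) = refl
  component-consComponent-wk a₀ α (ov n) = refl

  IsoAt : Ctx → List Fm → Sub → Sub → (ℕ → ArT) → ℕ → Entry → Set
  IsoAt Θ Φ σ₁ σ₂ α n obj = (Θ ⊢a α n ∶ so σ₁ n ⇒ so σ₂ n) × Given Θ Φ (IsIso (so σ₁ n) (so σ₂ n) (α n))
  IsoAt Θ Φ σ₁ σ₂ α n (arr a b) = Given Θ Φ (comp (sa σ₂ n) (component α a) ≐ comp (component α b) (sa σ₁ n))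

  -- The conditions on α need only be Given from the hypotheses Φ; in the theorem Φ is the
  -- single hypothesis that τ is a context isomorphism.
  record CtxIso (Λ Θ : Ctx) (Φ : List Fm) (σ₁ σ₂ : Sub) (α : ℕ → ArT) : Set where
    field
      ⊢Λ : ⊢ctx Λ
      ⊢Θ : ⊢ctx Θ
      σ₁-typed : TypedSub Λ Θ σ₁
      σ₂-typed : TypedSub Λ Θ σ₂
      iso-at : ∀ {n e} → Λ ∋ n ∶ e → IsoAt Θ Φ σ₁ σ₂ α n e

  module _ {Λ Θ Φ σ₁ σ₂ α} (d : CtxIso Λ Θ Φ σ₁ σ₂ α) where
    open CtxIso d

    component-⊢a : ∀ {a} → Λ ⊢o a → Θ ⊢a component α a ∶ subO σ₁ a ⇒ subO σ₂ a
    component-⊢a (oc c) = idt (oc c)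
    component-⊢a (ov p) = proj₁ (iso-at p)

    component-iso : ∀ {a} → Λ ⊢o a → Given Θ Φ (IsIso (subO σ₁ a) (subO σ₂ a) (component α a))
    component-iso (oc c) = id-iso (oc c)
    component-iso (ov p) = proj₂ (iso-at p)

    ctxIso-mono : ∀ {Ψ} → Φ ⊆ Ψ → CtxIso Λ Θ Ψ σ₁ σ₂ α
    ctxIso-mono i = record { ⊢Λ = ⊢Λ ; ⊢Θ = ⊢Θ ; σ₁-typed = σ₁-typed ; σ₂-typed = σ₂-typed ; iso-at = λ p → md p }
      where
        md : ∀ {n e} → Λ ∋ n ∶ e → IsoAt Θ _ σ₁ σ₂ α n e
        md {e = obj} p = proj₁ (iso-at p) , given-mono i (proj₂ (iso-at p))
        md {e = arr a b} p = given-mono i (iso-at p)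

    ctxIso-wk : ∀ {e'} → Θ ⊢e e' → CtxIso Λ (e' ∷ Θ) (map wkF Φ) (wkSub σ₁) (wkSub σ₂) (λ n → renA suc (α n))
    ctxIso-wk w = record
      { ⊢Λ = ⊢Λ ; ⊢Θ = w ∷ ⊢Θ ; σ₁-typed = wkSub-typed σ₁-typed ; σ₂-typed = wkSub-typed σ₂-typed ; iso-at = wd }
      where
        wd : ∀ {n e} → Λ ∋ n ∶ e → IsoAt _ (map wkF Φ) (wkSub σ₁) (wkSub σ₂) (λ n → renA suc (α n)) n e
        wd {n} {e = obj} p = wk-⊢a (proj₁ (iso-at p)) ,
           subst (Given _ _) (wkF-IsIso (so σ₁ n) (so σ₂ n) (α n)) (given-wk (proj₂ (iso-at p)))
        wd {n} {e = arr a b} p = subst (Given _ _)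
           (cong₂ (λ x y → comp (renA suc (sa σ₂ n)) x ≐ comp y (renA suc (sa σ₁ n))) (sym (component-wk α a)) (sym (component-wk α b)))
           (given-wk (iso-at p))

    HeadIso : Ctx → List Fm → ObT → ArT → ObT → ArT → ArT → Entry → Set
    HeadIso Θ' Φ' t₁ u₁ t₂ u₂ a₀ obj = (Θ' ⊢a a₀ ∶ t₁ ⇒ t₂) × Given Θ' Φ' (IsIso t₁ t₂ a₀)
    HeadIso Θ' Φ' t₁ u₁ t₂ u₂ a₀ (arr a b) =
      Given Θ' Φ' (comp u₂ (renA suc (component α a)) ≐ comp (renA suc (component α b)) u₁)

    ExtensionAt : Ctx → List Fm → ObT → ArT → ObT → ArT → ArT → Entry → Set
    ExtensionAt Θ' Φ' t₁ u₁ t₂ u₂ a₀ e =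
      HeadTyped Θ' σ₁ e t₁ u₁ × HeadTyped Θ' σ₂ e t₂ u₂ × HeadIso Θ' Φ' t₁ u₁ t₂ u₂ a₀ e

    ctxIso-ext : ∀ {e e' Φ' t₁ u₁ t₂ u₂ a₀} → Λ ⊢e e → Θ ⊢e e' → map wkF Φ ⊆ Φ' →
                 ExtensionAt (e' ∷ Θ) Φ' t₁ u₁ t₂ u₂ a₀ e →
                 CtxIso (e ∷ Λ) (e' ∷ Θ) Φ' (consSub t₁ u₁ (wkSub σ₁)) (consSub t₂ u₂ (wkSub σ₂)) (consComponent a₀ α)
    ctxIso-ext {e} {e'} {Φ'} {t₁} {u₁} {t₂} {u₂} {a₀} w w' inc (h₁ , h₂ , h) = record
      { ⊢Λ = w ∷ ⊢Λ ; ⊢Θ = w' ∷ ⊢Θ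
      ; σ₁-typed = consSub-typed σ₁-typed h₁ ; σ₂-typed = consSub-typed σ₂-typed h₂ ; iso-at = iso-at′ }
      where
        component-cons : ∀ a → component (consComponent a₀ α) (renO suc a) ≡ renA suc (component α a)
        component-cons = component-consComponent-wk a₀ α
        iso-at′ : ∀ {n e₀} → (e ∷ Λ) ∋ n ∶ e₀ →
                  IsoAt (e' ∷ Θ) Φ' (consSub t₁ u₁ (wkSub σ₁)) (consSub t₂ u₂ (wkSub σ₂)) (consComponent a₀ α) n e₀
        iso-at′ (here {e = obj}) = h
        iso-at′ (here {e = arr a b}) = subst (Given _ _)
           (cong₂ (λ x y → comp u₂ x ≐ comp y u₁) (sym (component-cons a)) (sym (component-cons b))) h
        iso-at′ (there {e = obj} p) = proj₁ (CtxIso.iso-at (ctxIso-wk w') p) , given-mono inc (proj₂ (CtxIso.iso-at (ctxIso-wk w') p))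
        iso-at′ {suc n} (there {e = arr a b} p) = subst (Given _ _)
           (cong₂ (λ x y → comp (renA suc (sa σ₂ n)) x ≐ comp y (renA suc (sa σ₁ n)))
              (trans (component-wk α a) (sym (component-cons a))) (trans (component-wk α b) (sym (component-cons b))))
           (given-mono inc (CtxIso.iso-at (ctxIso-wk w') p))

    naturality : ∀ {t a b} → Λ ⊢a t ∶ a ⇒ b →
           T ▸ Θ ∣ Φ ⊢ comp (subA σ₂ t) (component α a) ≐ comp (component α b) (subA σ₁ t)
    naturality (ac f) = begin (s ∘ₜ i) ≐⟨ identityʳₜ s ⟩ s ≐⟨ ≐-symₜ (j ∘ₜ s) s (identityˡₜ s) ⟩ (j ∘ₜ s) ∎
      where open Equational ⊢Θ {Φ}
            s = ac f ⦂ ac f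
            i = idt _ ⦂ idt (oc _)
            j = idt _ ⦂ idt (oc _)
    naturality (av p) = given-⊢ ⊢Θ (iso-at p)
    naturality (idt {a} o) = begin (i₂ ∘ₜ F) ≐⟨ identityˡₜ F ⟩ F ≐⟨ ≐-symₜ (F ∘ₜ i₁) F (identityʳₜ F) ⟩ (F ∘ₜ i₁) ∎
      where open Equational ⊢Θ {Φ}
            F = component α a ⦂ component-⊢a o
            i₁ = idt _ ⦂ idt (subO-⊢o σ₁-typed o)
            i₂ = idt _ ⦂ idt (subO-⊢o σ₂-typed o)
    naturality (comp {g} {f} {a} {b} {c} tg tf) =
        begin ((g₂ ∘ₜ f₂) ∘ₜ Fa)
          ≐⟨ ∘-assoc⁻ₜ g₂ f₂ Fa ⟩ (g₂ ∘ₜ (f₂ ∘ₜ Fa))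
          ≐⟨ ∘-congˡ g₂ (f₂ ∘ₜ Fa) (Fb ∘ₜ f₁) (naturality tf) ⟩ (g₂ ∘ₜ (Fb ∘ₜ f₁))
          ≐⟨ ∘-assocₜ g₂ Fb f₁ ⟩ ((g₂ ∘ₜ Fb) ∘ₜ f₁)
          ≐⟨ ∘-congʳ (g₂ ∘ₜ Fb) (Fc ∘ₜ g₁) f₁ (naturality tg) ⟩ ((Fc ∘ₜ g₁) ∘ₜ f₁)
          ≐⟨ ∘-assoc⁻ₜ Fc g₁ f₁ ⟩ (Fc ∘ₜ (g₁ ∘ₜ f₁)) ∎
      where open Equational ⊢Θ {Φ}
            oa = proj₁ (endpoints-⊢o ⊢Λ tf)
            ob = proj₂ (endpoints-⊢o ⊢Λ tf)
            oc' = proj₂ (endpoints-⊢o ⊢Λ tg)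
            Fa = component α a ⦂ component-⊢a oa
            Fb = component α b ⦂ component-⊢a ob
            Fc = component α c ⦂ component-⊢a oc'
            f₁ = subA σ₁ f ⦂ subA-⊢a σ₁-typed tf
            f₂ = subA σ₂ f ⦂ subA-⊢a σ₂-typed tf
            g₁ = subA σ₁ g ⦂ subA-⊢a σ₁-typed tg
            g₂ = subA σ₂ g ⦂ subA-⊢a σ₂-typed tg

  withInverse : ∀ {Λ Θ Φ σ₁ σ₂ α c} (d : CtxIso Λ Θ Φ σ₁ σ₂ α) (G : Fm) → Λ ⊢o c →
    (∀ {Φ'} → CtxIso Λ (arr (subO σ₂ c) (subO σ₁ c) ∷ Θ) Φ' (wkSub σ₁) (wkSub σ₂) (λ n → renA suc (α n)) →
       (arr (subO σ₂ c) (subO σ₁ c) ∷ Θ) ⊢a av zero ∶ subO (wkSub σ₂) c ⇒ subO (wkSub σ₁) c →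
       Conjunct Φ' (comp (av zero) (component (λ n → renA suc (α n)) c) ≐ idt (subO (wkSub σ₁) c)) →
       Conjunct Φ' (comp (component (λ n → renA suc (α n)) c) (av zero) ≐ idt (subO (wkSub σ₂) c)) →
       T ▸ arr (subO σ₂ c) (subO σ₁ c) ∷ Θ ∣ Φ' ⊢ wkF G) →
    T ▸ Θ ∣ Φ ⊢ G
  withInverse {Λ} {Θ} {Φ} {σ₁} {σ₂} {α} {c} d G oc' K =
      ∃E (given-⊢ ⊢Θ (component-iso d oc')) (K (ctxIso-mono (ctxIso-wk d w) Any.there)
        (cast-⊢a (sym (subO-wkSub σ₂ c)) (sym (subO-wkSub σ₁ c)) (av here))
        (subst (Conjunct _) (cong₂ (λ x y → comp (av zero) x ≐ idt y) (sym (component-wk α c)) (sym (subO-wkSub σ₁ c)))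
               (conj₁ (member first∈)))
        (subst (Conjunct _) (cong₂ (λ x y → comp x (av zero) ≐ idt y) (sym (component-wk α c)) (sym (subO-wkSub σ₂ c)))
               (conj₂ (member first∈))))
    where open CtxIso d
          w = arr (subO-⊢o σ₂-typed oc') (subO-⊢o σ₁-typed oc')

  module _ {Λ Θ Φ σ₁ σ₂ α a b} (d : CtxIso Λ Θ Φ σ₁ σ₂ α) (oa : Λ ⊢o a) (ob : Λ ⊢o b) where
    open CtxIso d

    -- For β an inverse of α b, a bound g : σ₂ a → σ₂ b corresponds to β ∘ g ∘ α a : σ₁ a → σ₁ b.
    transportedArrow : ArT → ArT
    transportedArrow β = comp (renA suc β) (comp (av zero) (renA suc (component α a)))

    transportedArrow-natural : ArT → Fm
    transportedArrow-natural β = comp (av zero) (renA suc (component α a)) ≐ comp (renA suc (component α b)) (transportedArrow β)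

    withTransportedArrow : ∀ {β Φ₁ G} → Θ ⊢a β ∶ subO σ₂ b ⇒ subO σ₁ b → Conjunct Φ (comp (component α b) β ≐ idt (subO σ₂ b)) →
      map wkF Φ ⊆ Φ₁ →
      (CtxIso (arr a b ∷ Λ) (arr (subO σ₂ a) (subO σ₂ b) ∷ Θ) (transportedArrow-natural β ∷ Φ₁)
         (consSub (ov zero) (transportedArrow β) (wkSub σ₁)) (consSub (ov zero) (av zero) (wkSub σ₂)) (consComponent (av zero) α) →
       T ▸ arr (subO σ₂ a) (subO σ₂ b) ∷ Θ ∣ transportedArrow-natural β ∷ Φ₁ ⊢ G) →
      T ▸ arr (subO σ₂ a) (subO σ₂ b) ∷ Θ ∣ Φ₁ ⊢ G
    withTransportedArrow {β} {Φ₁} {G} βty pr inc K =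
        ⇒E (⇒I (eq (typing (g ∘ₜ αa')) (typing (αb' ∘ₜ u))) (K d')) natDer
      where
        w' = arr (subO-⊢o σ₂-typed oa) (subO-⊢o σ₂-typed ob)
        cΘ' : ⊢ctx (arr (subO σ₂ a) (subO σ₂ b) ∷ Θ)
        cΘ' = w' ∷ ⊢Θ
        open Equational cΘ' {Φ₁}
        g = av zero ⦂ av here
        αa' = renA suc (component α a) ⦂ wk-⊢a (component-⊢a d oa)
        αb' = renA suc (component α b) ⦂ wk-⊢a (component-⊢a d ob)
        β' = renA suc β ⦂ wk-⊢a βty
        u = β' ∘ₜ (g ∘ₜ αa')
        idB = idₜ (wk-⊢o (subO-⊢o σ₂-typed ob))
        eqAB : T ▸ _ ∣ Φ₁ ⊢ (αb' ∘ₜ β') ≐ₜ idB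
        eqAB = conjunct-⊢ (conjunct-mono inc (conjunct-wk pr))
        natDer : T ▸ _ ∣ Φ₁ ⊢ transportedArrow-natural β
        natDer = ≐-symₜ (αb' ∘ₜ u) (g ∘ₜ αa')
          (begin (αb' ∘ₜ (β' ∘ₜ (g ∘ₜ αa')))
             ≐⟨ ∘-assocₜ αb' β' (g ∘ₜ αa') ⟩ ((αb' ∘ₜ β') ∘ₜ (g ∘ₜ αa'))
             ≐⟨ ∘-congʳ (αb' ∘ₜ β') idB (g ∘ₜ αa') eqAB ⟩ (idB ∘ₜ (g ∘ₜ αa'))
             ≐⟨ identityˡₜ (g ∘ₜ αa') ⟩ (g ∘ₜ αa') ∎)
        d' = ctxIso-ext d (arr oa ob) w' (λ x → Any.there (inc x)) (typing u , av here , conjunct (member first∈))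

    transportedArrow⁻ : ArT → ArT
    transportedArrow⁻ β = comp (renA suc (component α b)) (comp (av zero) (renA suc β))

    transportedArrow⁻-natural : ArT → Fm
    transportedArrow⁻-natural β = comp (transportedArrow⁻ β) (renA suc (component α a)) ≐ comp (renA suc (component α b)) (av zero)

    withTransportedArrow⁻ : ∀ {β Φ₁ G} → Θ ⊢a β ∶ subO σ₂ a ⇒ subO σ₁ a → Conjunct Φ (comp β (component α a) ≐ idt (subO σ₁ a)) →
      map wkF Φ ⊆ Φ₁ →
      (CtxIso (arr a b ∷ Λ) (arr (subO σ₁ a) (subO σ₁ b) ∷ Θ) (transportedArrow⁻-natural β ∷ Φ₁)
         (consSub (ov zero) (av zero) (wkSub σ₁)) (consSub (ov zero) (transportedArrow⁻ β) (wkSub σ₂)) (consComponent (av zero) α) →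
       T ▸ arr (subO σ₁ a) (subO σ₁ b) ∷ Θ ∣ transportedArrow⁻-natural β ∷ Φ₁ ⊢ G) →
      T ▸ arr (subO σ₁ a) (subO σ₁ b) ∷ Θ ∣ Φ₁ ⊢ G
    withTransportedArrow⁻ {β} {Φ₁} {G} βty pr inc K =
        ⇒E (⇒I (eq (typing (u ∘ₜ αa')) (typing (αb' ∘ₜ g))) (K d')) natDer
      where
        w' = arr (subO-⊢o σ₁-typed oa) (subO-⊢o σ₁-typed ob)
        cΘ' : ⊢ctx (arr (subO σ₁ a) (subO σ₁ b) ∷ Θ)
        cΘ' = w' ∷ ⊢Θ
        open Equational cΘ' {Φ₁}
        g = av zero ⦂ av here
        αa' = renA suc (component α a) ⦂ wk-⊢a (component-⊢a d oa)
        αb' = renA suc (component α b) ⦂ wk-⊢a (component-⊢a d ob)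
        β' = renA suc β ⦂ wk-⊢a βty
        u = αb' ∘ₜ (g ∘ₜ β')
        idA = idₜ (wk-⊢o (subO-⊢o σ₁-typed oa))
        eqBA : T ▸ _ ∣ Φ₁ ⊢ (β' ∘ₜ αa') ≐ₜ idA
        eqBA = conjunct-⊢ (conjunct-mono inc (conjunct-wk pr))
        natDer : T ▸ _ ∣ Φ₁ ⊢ transportedArrow⁻-natural β
        natDer =
          begin ((αb' ∘ₜ (g ∘ₜ β')) ∘ₜ αa')
             ≐⟨ ∘-assoc⁻ₜ αb' (g ∘ₜ β') αa' ⟩ (αb' ∘ₜ ((g ∘ₜ β') ∘ₜ αa'))
             ≐⟨ ∘-congˡ αb' ((g ∘ₜ β') ∘ₜ αa') (g ∘ₜ (β' ∘ₜ αa')) (∘-assoc⁻ₜ g β' αa') ⟩ (αb' ∘ₜ (g ∘ₜ (β' ∘ₜ αa')))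
             ≐⟨ ∘-congˡ αb' (g ∘ₜ (β' ∘ₜ αa')) (g ∘ₜ idA) (∘-congˡ g (β' ∘ₜ αa') idA eqBA) ⟩ (αb' ∘ₜ (g ∘ₜ idA))
             ≐⟨ ∘-congˡ αb' (g ∘ₜ idA) g (identityʳₜ g) ⟩ (αb' ∘ₜ g) ∎
        d' = ctxIso-ext d (arr oa ob) w' (λ x → Any.there (inc x)) (av here , typing u , conjunct (member first∈))

  wkF-⇒ : ∀ σ σ' P → (subF (wkSub σ) P ⇒' subF (wkSub σ') P) ≡ wkF (subF σ P ⇒' subF σ' P)
  wkF-⇒ σ σ' P = sym (cong₂ _⇒'_ (wkF-subF σ P) (wkF-subF σ' P))

  ∃-body : ∀ {Γ e φ} → Γ ⊢f ∃' e φ → (e ∷ Γ) ⊢f φ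
  ∃-body (ex _ w) = w

  module _ {Λ Θ Φ σ₁ σ₂ α f g a b} (d : CtxIso Λ Θ Φ σ₁ σ₂ α) (tf : Λ ⊢a f ∶ a ⇒ b) (tg : Λ ⊢a g ∶ a ⇒ b) where
    open CtxIso d
    private
      oa = proj₁ (endpoints-⊢o ⊢Λ tf)
      ob = proj₂ (endpoints-⊢o ⊢Λ tf)

    transport-≐ : ∀ {β} → Θ ⊢a β ∶ subO σ₂ a ⇒ subO σ₁ a → Conjunct Φ (comp (component α a) β ≐ idt (subO σ₂ a)) →
      T ▸ Θ ∣ Φ ⊢ (subA σ₁ f ≐ subA σ₁ g) ⇒' (subA σ₂ f ≐ subA σ₂ g)
    transport-≐ {β} βty pr = ⇒I (eq (subA-⊢a σ₁-typed tf) (subA-⊢a σ₁-typed tg))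
        (begin f₂ ≐⟨ ≐-symₜ (f₂ ∘ₜ idA) f₂ (identityʳₜ f₂) ⟩ (f₂ ∘ₜ idA)
            ≐⟨ ∘-congˡ f₂ idA (Fa ∘ₜ β') (≐-symₜ (Fa ∘ₜ β') idA E) ⟩ (f₂ ∘ₜ (Fa ∘ₜ β'))
            ≐⟨ ∘-assocₜ f₂ Fa β' ⟩ ((f₂ ∘ₜ Fa) ∘ₜ β')
            ≐⟨ ∘-congʳ (f₂ ∘ₜ Fa) (Fb ∘ₜ f₁) β' (naturality d₁ tf) ⟩ ((Fb ∘ₜ f₁) ∘ₜ β')
            ≐⟨ ∘-congʳ (Fb ∘ₜ f₁) (Fb ∘ₜ g₁) β' (∘-congˡ Fb f₁ g₁ (hyp first∈)) ⟩ ((Fb ∘ₜ g₁) ∘ₜ β')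
            ≐⟨ ∘-congʳ (Fb ∘ₜ g₁) (g₂ ∘ₜ Fa) β' (≐-symₜ (g₂ ∘ₜ Fa) (Fb ∘ₜ g₁) (naturality d₁ tg)) ⟩ ((g₂ ∘ₜ Fa) ∘ₜ β')
            ≐⟨ ∘-assoc⁻ₜ g₂ Fa β' ⟩ (g₂ ∘ₜ (Fa ∘ₜ β'))
            ≐⟨ ∘-congˡ g₂ (Fa ∘ₜ β') idA E ⟩ (g₂ ∘ₜ idA)
            ≐⟨ identityʳₜ g₂ ⟩ g₂ ∎)
      where
        Φ₁ = (subA σ₁ f ≐ subA σ₁ g) ∷ Φ
        d₁ = ctxIso-mono d {Φ₁} Any.there
        open Equational ⊢Θ {Φ₁}
        f₁ = subA σ₁ f ⦂ subA-⊢a σ₁-typed tf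
        f₂ = subA σ₂ f ⦂ subA-⊢a σ₂-typed tf
        g₁ = subA σ₁ g ⦂ subA-⊢a σ₁-typed tg
        g₂ = subA σ₂ g ⦂ subA-⊢a σ₂-typed tg
        Fa = component α a ⦂ component-⊢a d oa
        Fb = component α b ⦂ component-⊢a d ob
        β' = β ⦂ βty
        idA = idₜ (subO-⊢o σ₂-typed oa)
        E : T ▸ Θ ∣ Φ₁ ⊢ (Fa ∘ₜ β') ≐ₜ idA
        E = conjunct-⊢ (conjunct-mono Any.there pr)

    transport-≐⁻ : ∀ {β} → Θ ⊢a β ∶ subO σ₂ b ⇒ subO σ₁ b → Conjunct Φ (comp β (component α b) ≐ idt (subO σ₁ b)) →
      T ▸ Θ ∣ Φ ⊢ (subA σ₂ f ≐ subA σ₂ g) ⇒' (subA σ₁ f ≐ subA σ₁ g)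
    transport-≐⁻ {β} βty pr = ⇒I (eq (subA-⊢a σ₂-typed tf) (subA-⊢a σ₂-typed tg))
        (begin f₁ ≐⟨ ≐-symₜ (idB ∘ₜ f₁) f₁ (identityˡₜ f₁) ⟩ (idB ∘ₜ f₁)
            ≐⟨ ∘-congʳ idB (β' ∘ₜ Fb) f₁ (≐-symₜ (β' ∘ₜ Fb) idB E) ⟩ ((β' ∘ₜ Fb) ∘ₜ f₁)
            ≐⟨ ∘-assoc⁻ₜ β' Fb f₁ ⟩ (β' ∘ₜ (Fb ∘ₜ f₁))
            ≐⟨ ∘-congˡ β' (Fb ∘ₜ f₁) (f₂ ∘ₜ Fa) (≐-symₜ (f₂ ∘ₜ Fa) (Fb ∘ₜ f₁) (naturality d₁ tf)) ⟩ (β' ∘ₜ (f₂ ∘ₜ Fa))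
            ≐⟨ ∘-congˡ β' (f₂ ∘ₜ Fa) (g₂ ∘ₜ Fa) (∘-congʳ f₂ g₂ Fa (hyp first∈)) ⟩ (β' ∘ₜ (g₂ ∘ₜ Fa))
            ≐⟨ ∘-congˡ β' (g₂ ∘ₜ Fa) (Fb ∘ₜ g₁) (naturality d₁ tg) ⟩ (β' ∘ₜ (Fb ∘ₜ g₁))
            ≐⟨ ∘-assocₜ β' Fb g₁ ⟩ ((β' ∘ₜ Fb) ∘ₜ g₁)
            ≐⟨ ∘-congʳ (β' ∘ₜ Fb) idB g₁ E ⟩ (idB ∘ₜ g₁)
            ≐⟨ identityˡₜ g₁ ⟩ g₁ ∎)
      where
        Φ₁ = (subA σ₂ f ≐ subA σ₂ g) ∷ Φ
        d₁ = ctxIso-mono d {Φ₁} Any.there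
        open Equational ⊢Θ {Φ₁}
        f₁ = subA σ₁ f ⦂ subA-⊢a σ₁-typed tf
        f₂ = subA σ₂ f ⦂ subA-⊢a σ₂-typed tf
        g₁ = subA σ₁ g ⦂ subA-⊢a σ₁-typed tg
        g₂ = subA σ₂ g ⦂ subA-⊢a σ₂-typed tg
        Fa = component α a ⦂ component-⊢a d oa
        Fb = component α b ⦂ component-⊢a d ob
        β' = β ⦂ βty
        idB = idₜ (subO-⊢o σ₁-typed ob)
        E : T ▸ Θ ∣ Φ₁ ⊢ (β' ∘ₜ Fb) ≐ₜ idB
        E = conjunct-⊢ (conjunct-mono Any.there pr)

  Transports : Ctx → Fm → Set
  Transports Λ φ = ∀ {Θ' Φ' σ₁' σ₂' α'} → CtxIso Λ Θ' Φ' σ₁' σ₂' α' →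
            (T ▸ Θ' ∣ Φ' ⊢ subF σ₁' φ ⇒' subF σ₂' φ) × (T ▸ Θ' ∣ Φ' ⊢ subF σ₂' φ ⇒' subF σ₁' φ)

  module _ {Λ Θ Φ σ₁ σ₂ α a b φ} (d : CtxIso Λ Θ Φ σ₁ σ₂ α) (oa : Λ ⊢o a) (ob : Λ ⊢o b)
           (p : (arr a b ∷ Λ) ⊢f φ) (IH : Transports (arr a b ∷ Λ) φ) where
    open CtxIso d
    private
      w₁ : Θ ⊢e arr (subO σ₁ a) (subO σ₁ b)
      w₁ = arr (subO-⊢o σ₁-typed oa) (subO-⊢o σ₁-typed ob)
      w₂ : Θ ⊢e arr (subO σ₂ a) (subO σ₂ b)
      w₂ = arr (subO-⊢o σ₂-typed oa) (subO-⊢o σ₂-typed ob)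

    transport-∀ : ∀ {β} → Θ ⊢a β ∶ subO σ₂ b ⇒ subO σ₁ b → Conjunct Φ (comp (component α b) β ≐ idt (subO σ₂ b)) →
      T ▸ Θ ∣ Φ ⊢ subF σ₁ (∀' (arr a b) φ) ⇒' subF σ₂ (∀' (arr a b) φ)
    transport-∀ {β} βty pr = ⇒I (subF-⊢f σ₁-typed (all (arr oa ob) p)) (∀I w₂ (withTransportedArrow d oa ob βty pr Any.there
      (λ d'' → cast⊢ (sym (subF-liftS≡consSub σ₂ φ)) (⇒E (proj₁ (IH d''))
         (cast⊢ (subF-sub0A-liftS (transportedArrow d oa ob β) σ₁ φ)
           (∀Ea (hyp second∈) (comp (wk-⊢a βty) (comp (av here) (wk-⊢a (component-⊢a d oa))))))))))

    transport-∀⁻ : ∀ {β} → Θ ⊢a β ∶ subO σ₂ a ⇒ subO σ₁ a → Conjunct Φ (comp β (component α a) ≐ idt (subO σ₁ a)) →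
      T ▸ Θ ∣ Φ ⊢ subF σ₂ (∀' (arr a b) φ) ⇒' subF σ₁ (∀' (arr a b) φ)
    transport-∀⁻ {β} βty pr = ⇒I (subF-⊢f σ₂-typed (all (arr oa ob) p)) (∀I w₁ (withTransportedArrow⁻ d oa ob βty pr Any.there
      (λ d'' → cast⊢ (sym (subF-liftS≡consSub σ₁ φ)) (⇒E (proj₂ (IH d''))
         (cast⊢ (subF-sub0A-liftS (transportedArrow⁻ d oa ob β) σ₂ φ)
           (∀Ea (hyp second∈) (comp (wk-⊢a (component-⊢a d ob)) (comp (av here) (wk-⊢a βty)))))))))

    transport-∃ : ∀ {β} → Θ ⊢a β ∶ subO σ₂ a ⇒ subO σ₁ a → Conjunct Φ (comp β (component α a) ≐ idt (subO σ₁ a)) →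
      T ▸ Θ ∣ Φ ⊢ subF σ₁ (∃' (arr a b) φ) ⇒' subF σ₂ (∃' (arr a b) φ)
    transport-∃ {β} βty pr = ⇒I (subF-⊢f σ₁-typed (ex (arr oa ob) p)) (∃E (hyp first∈)
      (withTransportedArrow⁻ d oa ob βty pr (λ x → Any.there (Any.there x)) (λ d'' →
        ∃Ia (wk-⊢e w₂) (∃-body (wkF-⊢f (subF-⊢f σ₂-typed (ex (arr oa ob) p))))
          (comp (wk-⊢a (component-⊢a d ob)) (comp (av here) (wk-⊢a βty)))
          (cast⊢ (sym (subF-sub0A-liftS (transportedArrow⁻ d oa ob β) σ₂ φ))
            (⇒E (proj₁ (IH d'')) (cast⊢ (subF-liftS≡consSub σ₁ φ) (hyp second∈)))))))

    transport-∃⁻ : ∀ {β} → Θ ⊢a β ∶ subO σ₂ b ⇒ subO σ₁ b → Conjunct Φ (comp (component α b) β ≐ idt (subO σ₂ b)) →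
      T ▸ Θ ∣ Φ ⊢ subF σ₂ (∃' (arr a b) φ) ⇒' subF σ₁ (∃' (arr a b) φ)
    transport-∃⁻ {β} βty pr = ⇒I (subF-⊢f σ₂-typed (ex (arr oa ob) p)) (∃E (hyp first∈)
      (withTransportedArrow d oa ob βty pr (λ x → Any.there (Any.there x)) (λ d'' →
        ∃Ia (wk-⊢e w₁) (∃-body (wkF-⊢f (subF-⊢f σ₁-typed (ex (arr oa ob) p))))
          (comp (wk-⊢a βty) (comp (av here) (wk-⊢a (component-⊢a d oa))))
          (cast⊢ (sym (subF-sub0A-liftS (transportedArrow d oa ob β) σ₁ φ))
            (⇒E (proj₂ (IH d'')) (cast⊢ (subF-liftS≡consSub σ₂ φ) (hyp second∈)))))))

  transport : ∀ {Λ Θ Φ σ₁ σ₂ α P} → CtxIso Λ Θ Φ σ₁ σ₂ α → Λ ⊢f P →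
              (T ▸ Θ ∣ Φ ⊢ subF σ₁ P ⇒' subF σ₂ P) × (T ▸ Θ ∣ Φ ⊢ subF σ₂ P ⇒' subF σ₁ P)
  transport d top = ⇒I top ⊤I , ⇒I top ⊤I
  transport d bot = ⇒I bot (hyp first∈) , ⇒I bot (hyp first∈)
  transport d (and p q) =
      ⇒I (subF-⊢f σ₁-typed (and p q)) (∧I (⇒E (proj₁ (transport d' p)) (∧E₁ (hyp first∈)))
                                          (⇒E (proj₁ (transport d' q)) (∧E₂ (hyp first∈)))) ,
      ⇒I (subF-⊢f σ₂-typed (and p q)) (∧I (⇒E (proj₂ (transport d' p)) (∧E₁ (hyp first∈)))
                                          (⇒E (proj₂ (transport d' q)) (∧E₂ (hyp first∈))))
    where open CtxIso d
          d' : ∀ {χ} → CtxIso _ _ (χ ∷ _) _ _ _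
          d' = ctxIso-mono d Any.there
  transport d (or p q) =
      ⇒I (subF-⊢f σ₁-typed (or p q)) (∨E (hyp first∈) (∨I₁ (subF-⊢f σ₂-typed q) (⇒E (proj₁ (transport d' p)) (hyp first∈)))
                                                      (∨I₂ (subF-⊢f σ₂-typed p) (⇒E (proj₁ (transport d' q)) (hyp first∈)))) ,
      ⇒I (subF-⊢f σ₂-typed (or p q)) (∨E (hyp first∈) (∨I₁ (subF-⊢f σ₁-typed q) (⇒E (proj₂ (transport d' p)) (hyp first∈)))
                                                      (∨I₂ (subF-⊢f σ₁-typed p) (⇒E (proj₂ (transport d' q)) (hyp first∈))))
    where open CtxIso d
          d' : ∀ {χ χ'} → CtxIso _ _ (χ ∷ χ' ∷ _) _ _ _
          d' = ctxIso-mono d (λ x → Any.there (Any.there x))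
  transport d (imp p q) =
      ⇒I (subF-⊢f σ₁-typed (imp p q)) (⇒I (subF-⊢f σ₂-typed p)
        (⇒E (proj₁ (transport d' q)) (⇒E (hyp second∈) (⇒E (proj₂ (transport d' p)) (hyp first∈))))) ,
      ⇒I (subF-⊢f σ₂-typed (imp p q)) (⇒I (subF-⊢f σ₁-typed p)
        (⇒E (proj₂ (transport d' q)) (⇒E (hyp second∈) (⇒E (proj₁ (transport d' p)) (hyp first∈)))))
    where open CtxIso d
          d' : ∀ {χ χ'} → CtxIso _ _ (χ ∷ χ' ∷ _) _ _ _
          d' = ctxIso-mono d (λ x → Any.there (Any.there x))
  transport {σ₁ = σ₁} {σ₂} d (eq {f} {g} tf tg) =
      withInverse d _ (proj₁ (endpoints-⊢o ⊢Λ tf))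
        (λ d' βty _ right → cast⊢ (wkF-⇒ σ₁ σ₂ (f ≐ g)) (transport-≐ d' tf tg βty right)) ,
      withInverse d _ (proj₂ (endpoints-⊢o ⊢Λ tf))
        (λ d' βty left _ → cast⊢ (wkF-⇒ σ₂ σ₁ (f ≐ g)) (transport-≐⁻ d' tf tg βty left))
    where open CtxIso d
  transport {σ₁ = σ₁} {σ₂} d (all {φ = φ} obj p) =
      ⇒I (subF-⊢f σ₁-typed (all obj p)) (∀I obj (cast⊢ (sym (subF-liftS≡consSub σ₂ φ))
         (⇒E (proj₁ (transport d' p)) (cast⊢ (subF-sub0O-liftS (ov zero) σ₁ φ) (∀Eo (hyp first∈) (ov here)))))) ,
      ⇒I (subF-⊢f σ₂-typed (all obj p)) (∀I obj (cast⊢ (sym (subF-liftS≡consSub σ₁ φ))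
         (⇒E (proj₂ (transport d' p)) (cast⊢ (subF-sub0O-liftS (ov zero) σ₂ φ) (∀Eo (hyp first∈) (ov here))))))
    where open CtxIso d
          d' : ∀ {χ} → CtxIso _ _ (χ ∷ map wkF _) _ _ _
          d' = ctxIso-ext d {u₁ = av zero} {u₂ = av zero} obj obj Any.there
                 (ov here , ov here , idt (ov here) , id-iso (ov here))
  transport {σ₁ = σ₁} {σ₂} d (all {e = arr a b} {φ = φ} (arr oa ob) p) =
      withInverse d _ ob (λ d' βty _ right →
        cast⊢ (wkF-⇒ σ₁ σ₂ (∀' (arr a b) φ)) (transport-∀ d' oa ob p (λ d″ → transport d″ p) βty right)) ,
      withInverse d _ oa (λ d' βty left _ →
        cast⊢ (wkF-⇒ σ₂ σ₁ (∀' (arr a b) φ)) (transport-∀⁻ d' oa ob p (λ d″ → transport d″ p) βty left))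
  transport {σ₁ = σ₁} {σ₂} d (ex {φ = φ} obj p) =
      ⇒I (subF-⊢f σ₁-typed (ex obj p)) (∃E (hyp first∈) (∃Io (∃-body (wkF-⊢f (subF-⊢f σ₂-typed (ex obj p)))) (ov here)
         (cast⊢ (sym (subF-sub0O-liftS (ov zero) σ₂ φ))
           (⇒E (proj₁ (transport d' p)) (cast⊢ (subF-liftS≡consSub σ₁ φ) (hyp first∈)))))) ,
      ⇒I (subF-⊢f σ₂-typed (ex obj p)) (∃E (hyp first∈) (∃Io (∃-body (wkF-⊢f (subF-⊢f σ₁-typed (ex obj p)))) (ov here)
         (cast⊢ (sym (subF-sub0O-liftS (ov zero) σ₁ φ))
           (⇒E (proj₂ (transport d' p)) (cast⊢ (subF-liftS≡consSub σ₂ φ) (hyp first∈))))))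
    where open CtxIso d
          d' : ∀ {χ χ'} → CtxIso _ _ (χ ∷ χ' ∷ map wkF _) _ _ _
          d' = ctxIso-ext d {u₁ = av zero} {u₂ = av zero} obj obj (λ x → Any.there (Any.there x))
                 (ov here , ov here , idt (ov here) , id-iso (ov here))
  transport {σ₁ = σ₁} {σ₂} d (ex {e = arr a b} {φ = φ} (arr oa ob) p) =
      withInverse d _ oa (λ d' βty left _ →
        cast⊢ (wkF-⇒ σ₁ σ₂ (∃' (arr a b) φ)) (transport-∃ d' oa ob p (λ d″ → transport d″ p) βty left)) ,
      withInverse d _ ob (λ d' βty _ right →
        cast⊢ (wkF-⇒ σ₂ σ₁ (∃' (arr a b) φ)) (transport-∃⁻ d' oa ob p (λ d″ → transport d″ p) βty right))

<ᵇ≡true⇒< : ∀ n m → (n <ᵇ m) ≡ true → n < m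
<ᵇ≡true⇒< n m e = <ᵇ⇒< n m (subst T (sym e) tt)

<⇒<ᵇ≡true : ∀ {n m} → n < m → (n <ᵇ m) ≡ true
<⇒<ᵇ≡true lt = Equivalence.to T-≡ (<⇒<ᵇ lt)

<ᵇ≡false⇒≥ : ∀ n m → (n <ᵇ m) ≡ false → m ≤ n
<ᵇ≡false⇒≥ n m e = ≮⇒≥ (λ lt → subst T e (<⇒<ᵇ lt))

≡ᵇ≡true⇒≡ : ∀ i n → (i ≡ᵇ n) ≡ true → i ≡ n
≡ᵇ≡true⇒≡ i n e = ≡ᵇ⇒≡ i n (subst T (sym e) tt)

≡ᵇ-refl : ∀ n → (n ≡ᵇ n) ≡ true
≡ᵇ-refl n = Equivalence.to T-≡ (≡⇒≡ᵇ n n refl)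

module Positions (S : Signature) where
  open Lang S

  fOf-just⇒∈ : ∀ is {n p} → fOf is n ≡ just p → n ∈ is
  fOf-just⇒∈ [] ()
  fOf-just⇒∈ (i ∷ is) {n} h with i ≡ᵇ n in eq
  ... | true = Any.here (sym (≡ᵇ≡true⇒≡ i n eq))
  ... | false with fOf is n in e2
  ...   | just q = Any.there (fOf-just⇒∈ is e2)
  fOf-just⇒∈ (i ∷ is) {n} () | false | nothing

  ∈⇒fOf-just : ∀ is {n} → n ∈ is → Σ ℕ (λ p → fOf is n ≡ just p)
  ∈⇒fOf-just (i ∷ is) {n} m with i ≡ᵇ n in eq
  ... | true = zero , refl
  ∈⇒fOf-just (i ∷ is) {n} (Any.here refl) | false rewrite ≡ᵇ-refl i = ⊥-elim (bad eq)
    where bad : true ≡ false → ⊥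
          bad ()
  ∈⇒fOf-just (i ∷ is) {n} (Any.there m) | false with ∈⇒fOf-just is m
  ... | q , e rewrite e = suc q , refl

  fOf-nothing : ∀ is {n} → (∀ {i} → i ∈ is → i < n) → fOf is n ≡ nothing
  fOf-nothing [] h = refl
  fOf-nothing (i ∷ is) {n} h with i ≡ᵇ n in eq
  ... | true = ⊥-elim (<-irrefl (≡ᵇ≡true⇒≡ i n eq) (h (Any.here refl)))
  ... | false rewrite fOf-nothing is (λ x → h (Any.there x)) = refl

module CopyInstance (S : Signature) (T : Lang.Theory S) (Γ Δ : Lang.Ctx S) (⊢ΔΓ : Lang.⊢ctx S (Δ ++ Γ)) where
  open Lang S
  open Substitution S
  open Typing S
  open Derivations S T
  open GivenFacts S T
  open Transport S T
  open Renaming S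
  open Positions S
  open Iso Δ

  length-copy₂ : ∀ Ξ → length (copy₂' Ξ) ≡ length Ξ
  length-copy₂ [] = refl
  length-copy₂ (e ∷ Ξ) = cong suc (length-copy₂ Ξ)

  length-isoArrows : ∀ is → length (isoArrows' is) ≡ length is
  length-isoArrows [] = refl
  length-isoArrows (i ∷ is) = cong suc (length-isoArrows is)

  liftR-above : ∀ c n → liftR (above c m) n ≡ above (suc c) m n
  liftR-above c zero = refl
  liftR-above c (suc n) with n <ᵇ c
  ... | true = refl
  ... | false = refl

  copy₂-typedRen : ∀ Ξ → TypedRen (Ξ ++ Γ) (copy₂' Ξ ++ (Δ ++ Γ)) (above (length Ξ) m)
  copy₂-typedRen [] = typedRen-ext (typedRen-shift Δ) (λ n → +-comm m n)
  copy₂-typedRen (e ∷ Ξ) = typedRen-ext (typedRen-liftR (copy₂-typedRen Ξ)) (liftR-above (length Ξ))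

  copiesCtx : Ctx
  copiesCtx = copy₂ ++ (Δ ++ Γ)

  bigCtx : Ctx
  bigCtx = isoArrows ++ copiesCtx

  r₂-typed : TypedRen (Δ ++ Γ) bigCtx r₂
  r₂-typed = typedRen-ext (typedRen-∘ (copy₂-typedRen Δ) (typedRen-shift isoArrows)) h
    where
      h : ∀ n → length isoArrows + above m m n ≡ r₂ n
      h n rewrite length-isoArrows os with n <ᵇ m
      ... | true = +-comm k n
      ... | false = trans (+-comm k (n + m)) (+-assoc n m k)

  r₁-typed : TypedRen (Δ ++ Γ) bigCtx r₁
  r₁-typed = typedRen-ext (typedRen-∘ (typedRen-shift copy₂) (typedRen-shift isoArrows)) h
    where
      h : ∀ n → length isoArrows + (length copy₂ + n) ≡ r₁ n
      h n rewrite length-isoArrows os | length-copy₂ Δ =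
        trans (sym (+-assoc k m n)) (trans (+-comm (k + m) n) (cong (n +_) (+-comm k m)))

  copy₂-ctx : ∀ Ξ → ⊢ctx (Ξ ++ Γ) → ⊢ctx (copy₂' Ξ ++ (Δ ++ Γ))
  copy₂-ctx [] c = ⊢ΔΓ
  copy₂-ctx (e ∷ Ξ) (w ∷ c) = renE-⊢e (copy₂-typedRen Ξ) w ∷ copy₂-ctx Ξ c

  obPos-sound : ∀ j Ξ {i} → i ∈ obPos j Ξ → Σ ℕ (λ p → (i ≡ p + j) × ((Ξ ++ Γ) ∋ p ∶ obj) × (p < length Ξ))
  obPos-sound j [] ()
  obPos-sound j (obj ∷ Ξ) (Any.here refl) = zero , refl , here , s≤s z≤n
  obPos-sound j (obj ∷ Ξ) (Any.there x) with obPos-sound (suc j) Ξ x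
  ... | p , e , l , lt = suc p , trans e (+-suc p j) , there l , s≤s lt
  obPos-sound j (arr a b ∷ Ξ) x with obPos-sound (suc j) Ξ x
  ... | p , e , l , lt = suc p , trans e (+-suc p j) , there l , s≤s lt

  os-sound : ∀ {i} → i ∈ os → ((Δ ++ Γ) ∋ i ∶ obj) × (i < m)
  os-sound x with obPos-sound zero Δ x
  ... | p , e , l , lt rewrite +-identityʳ p = subst (λ z → ((Δ ++ Γ) ∋ z ∶ obj) × (z < m)) (sym e) (l , lt)

  isoArrows-ctx : ∀ is → (∀ {i} → i ∈ is → (copiesCtx ∋ i + m ∶ obj) × (copiesCtx ∋ i ∶ obj)) → ⊢ctx (isoArrows' is ++ copiesCtx)
  isoArrows-ctx [] h = copy₂-ctx Δ ⊢ΔΓ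
  isoArrows-ctx (i ∷ is) h =
      arr (ov (cast-∋ e1 refl (typedRen-shift (isoArrows' is) (proj₁ (h (Any.here refl))))))
          (ov (cast-∋ e2 refl (typedRen-shift (isoArrows' is) (proj₂ (h (Any.here refl)))))) ∷
      isoArrows-ctx is (λ x → h (Any.there x))
    where
      e1 : length (isoArrows' is) + (i + m) ≡ i + m + length is
      e1 rewrite length-isoArrows is = +-comm (length is) (i + m)
      e2 : length (isoArrows' is) + i ≡ i + length is
      e2 rewrite length-isoArrows is = +-comm (length is) i

  above-below : ∀ {i} → i < m → above m m i ≡ i
  above-below lt rewrite <⇒<ᵇ≡true lt = refl

  ⊢bigCtx : ⊢ctx bigCtx
  ⊢bigCtx = isoArrows-ctx os h
    where
      h : ∀ {i} → i ∈ os → (copiesCtx ∋ i + m ∶ obj) × (copiesCtx ∋ i ∶ obj)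
      h {i} x = cast-∋ (trans (cong (_+ i) (length-copy₂ Δ)) (+-comm m i)) refl (typedRen-shift copy₂ (proj₁ (os-sound x))) ,
                cast-∋ (above-below (proj₂ (os-sound x))) refl (copy₂-typedRen Δ (proj₁ (os-sound x)))

  isoArrow-lookup : ∀ is {Z n p} → fOf is n ≡ just p → (isoArrows' is ++ Z) ∋ p ∶ arr (ov (n + m + length is)) (ov (n + length is))
  isoArrow-lookup [] ()
  isoArrow-lookup (i ∷ is) {Z} {n} h with i ≡ᵇ n in eq
  isoArrow-lookup (i ∷ is) {Z} {n} refl | true rewrite ≡ᵇ≡true⇒≡ i n eq =
    cast-∋ refl (cong₂ (λ x y → arr (ov x) (ov y)) (sym (+-suc (n + m) (length is))) (sym (+-suc n (length is)))) here
  ... | false with fOf is n in e2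
  isoArrow-lookup (i ∷ is) {Z} {n} refl | false | just q =
    cast-∋ refl (cong₂ (λ x y → arr (ov x) (ov y)) (sym (+-suc (n + m) (length is))) (sym (+-suc n (length is))))
      (there (isoArrow-lookup is e2))
  isoArrow-lookup (i ∷ is) {Z} {n} () | false | nothing

  obPos-complete : ∀ j Ξ {n e} → (Ξ ++ Γ) ∋ n ∶ e → e ≡ obj → n < length Ξ → (n + j) ∈ obPos j Ξ
  obPos-complete j (obj ∷ Ξ) here e lt = Any.here refl
  obPos-complete j (arr a b ∷ Ξ) here () lt
  obPos-complete j (obj ∷ Ξ) {suc n} (there {e = obj} p) e (s≤s lt) =
    Any.there (subst (_∈ obPos (suc j) Ξ) (+-suc n j) (obPos-complete (suc j) Ξ p refl lt))
  obPos-complete j (arr a b ∷ Ξ) {suc n} (there {e = obj} p) e (s≤s lt) =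
    subst (_∈ obPos (suc j) Ξ) (+-suc n j) (obPos-complete (suc j) Ξ p refl lt)
  obPos-complete j (x ∷ Ξ) (there {e = arr a b} p) () lt

  os-complete : ∀ {n} → (Δ ++ Γ) ∋ n ∶ obj → n < m → n ∈ os
  os-complete {n} p lt = subst (_∈ os) (+-identityʳ n) (obPos-complete zero Δ p refl lt)

  outsideΔ-shifted : ∀ Ξ {n e} → (Ξ ++ Γ) ∋ n ∶ e → length Ξ ≤ n → Σ Entry (λ e' → e ≡ renE (λ x → length Ξ + x) e')
  outsideΔ-shifted [] {e = e} p _ = e , sym (renE-id e)
  outsideΔ-shifted (x ∷ Ξ) here ()
  outsideΔ-shifted (x ∷ Ξ) (there {e = e₀} p) (s≤s le) with outsideΔ-shifted Ξ p le
  ... | e' , E = e' , trans (cong (renE suc) E) (renE-∘ suc _ e')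

  os-< : ∀ {i} → i ∈ os → i < m
  os-< x = proj₂ (os-sound x)

  fOf-outsideΔ : ∀ {n} → m ≤ n → fOf os n ≡ nothing
  fOf-outsideΔ le = fOf-nothing os (λ x → <-≤-trans (os-< x) le)

  r₂-insideΔ : ∀ {n} → n < m → r₂ n ≡ n + k
  r₂-insideΔ lt rewrite <⇒<ᵇ≡true lt = refl

  r₂-outsideΔ : ∀ {n} → (n <ᵇ m) ≡ false → r₂ n ≡ r₁ n
  r₂-outsideΔ e rewrite e = refl

  α : ℕ → ArT
  α n = fTerm (ov n)

  α-⊢a : ∀ {n} → (Δ ++ Γ) ∋ n ∶ obj → bigCtx ⊢a α n ∶ ov (r₁ n) ⇒ ov (r₂ n)
  α-⊢a {n} p with fOf os n in eq
  ... | just q = av (cast-∋ refl (cong₂ (λ x y → arr (ov x) (ov y)) (+-assoc n m k) (sym (r₂-insideΔ (os-< (fOf-just⇒∈ os eq)))))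
                   (isoArrow-lookup os eq))
  ... | nothing with n <ᵇ m in lt
  ...   | false = idt (ov (r₁-typed p))
  ...   | true with ∈⇒fOf-just os (os-complete p (<ᵇ≡true⇒< n m lt))
  ...     | q , e = ⊥-elim (bad (trans (sym eq) e))
    where bad : ∀ {q : ℕ} → nothing ≡ just q → ⊥
          bad ()

  conditionFor : ℕ → Entry → Fm
  conditionFor j obj = IsIso (ov (r₁ j)) (ov (r₂ j)) (fTerm (ov j))
  conditionFor j (arr a b) = comp (av (r₂ j)) (fTerm a) ≐ comp (fTerm b) (av (r₁ j))

  renO-shift-suc : ∀ i a → renO (λ x → x + i) (renO suc a) ≡ renO (λ n → n + suc i) a
  renO-shift-suc i a = trans (renO-∘ _ suc a) (renO-ext (λ x → sym (+-suc x i)) a)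

  renE-shift-suc : ∀ i e → renE (λ x → x + i) (renE suc e) ≡ renE (λ n → n + suc i) e
  renE-shift-suc i e = trans (renE-∘ _ suc e) (renE-ext (λ x → sym (+-suc x i)) e)

  conds-conjunct : ∀ i Ξ {Φ n e} → Conjunct Φ (foldr _∧'_ ⊤' (conds i Ξ)) → (Ξ ++ Γ) ∋ n ∶ e → n < length Ξ →
          Conjunct Φ (conditionFor (n + i) (renE (λ x → x + i) e))
  conds-conjunct i [] pr p ()
  conds-conjunct i (obj ∷ Ξ) pr here _ = conj₁ pr
  conds-conjunct i (arr a b ∷ Ξ) pr here _ = subst (Conjunct _)
    (cong₂ (λ x y → comp (av (r₂ i)) (fTerm x) ≐ comp (fTerm y) (av (r₁ i))) (sym (renO-shift-suc i a)) (sym (renO-shift-suc i b))) (conj₁ pr)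
  conds-conjunct i (obj ∷ Ξ) pr (there {e = e} {n = n} p) (s≤s lt) =
    subst (Conjunct _) (cong₂ conditionFor (+-suc n i) (sym (renE-shift-suc i e))) (conds-conjunct (suc i) Ξ (conj₂ pr) p lt)
  conds-conjunct i (arr a b ∷ Ξ) pr (there {e = e} {n = n} p) (s≤s lt) =
    subst (Conjunct _) (cong₂ conditionFor (+-suc n i) (sym (renE-shift-suc i e))) (conds-conjunct (suc i) Ξ (conj₂ pr) p lt)

  renE-+0 : ∀ e → renE (λ x → x + 0) e ≡ e
  renE-+0 e = trans (renE-ext +-identityʳ e) (renE-id e)

  component≡fTerm : ∀ a → component α a ≡ fTerm a
  component≡fTerm (oc c) = refl
  component≡fTerm (ov n) = refl

  component-outsideΔ : ∀ a' → component α (renO (λ x → m + x) a') ≡ idt (subO (renSub r₁) (renO (λ x → m + x) a'))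
  component-outsideΔ (oc c) = refl
  component-outsideΔ (ov j) = cong (maybe av (idt (ov (r₁ (m + j))))) (fOf-outsideΔ (m≤m+n m j))

  Φ₀ : List Fm
  Φ₀ = isCtxIso ∷ []

  condition-insideΔ : ∀ {n e} → (Δ ++ Γ) ∋ n ∶ e → n < m → Conjunct Φ₀ (conditionFor n e)
  condition-insideΔ {n} {e} p lt =
    subst (Conjunct Φ₀) (cong₂ conditionFor (+-identityʳ n) (renE-+0 e)) (conds-conjunct zero Δ (member first∈) p lt)

  caseBool : ∀ {A : Set} b → (b ≡ true → A) → (b ≡ false → A) → A
  caseBool true f g = f refl
  caseBool false f g = g refl

  -- Variables of Γ occur identically in both copies, and α is the identity on them.
  iso-at-outsideΔ : ∀ {n a b} → (Δ ++ Γ) ∋ n ∶ arr a b → (n <ᵇ m) ≡ false → IsoAt bigCtx Φ₀ (renSub r₁) (renSub r₂) α n (arr a b)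
  iso-at-outsideΔ {n} p lt with outsideΔ-shifted Δ p (<ᵇ≡false⇒≥ n m lt)
  ... | obj , ()
  ... | arr a' b' , refl = subst (Given bigCtx Φ₀)
            (cong₃ (λ x y z → comp (av x) y ≐ comp z (av (r₁ n))) (sym (r₂-outsideΔ lt)) (sym (component-outsideΔ a')) (sym (component-outsideΔ b')))
            (id-natural (renSub-typed r₁-typed p))

  iso-at : ∀ {n e} → (Δ ++ Γ) ∋ n ∶ e → IsoAt bigCtx Φ₀ (renSub r₁) (renSub r₂) α n e
  iso-at {n} {obj} p = α-⊢a p , caseBool (n <ᵇ m)
      (λ lt → conjunct (condition-insideΔ p (<ᵇ≡true⇒< n m lt)))
      (λ lt → subst (Given bigCtx Φ₀) (cong₂ (λ x y → IsIso (ov (r₁ n)) (ov x) y) (sym (r₂-outsideΔ lt))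
                      (sym (cong (maybe av (idt (ov (r₁ n)))) (fOf-outsideΔ (<ᵇ≡false⇒≥ n m lt))))) (id-iso (ov (r₁-typed p))))
  iso-at {n} {arr a b} p = caseBool (n <ᵇ m)
      (λ lt → conjunct (subst (Conjunct Φ₀) (cong₂ (λ x y → comp (av (r₂ n)) x ≐ comp y (av (r₁ n))) (sym (component≡fTerm a)) (sym (component≡fTerm b)))
                   (condition-insideΔ p (<ᵇ≡true⇒< n m lt))))
      (iso-at-outsideΔ p)

  copiesIso : CtxIso (Δ ++ Γ) bigCtx Φ₀ (renSub r₁) (renSub r₂) α
  copiesIso = record
    { ⊢Λ = ⊢ΔΓ ; ⊢Θ = ⊢bigCtx ; σ₁-typed = renSub-typed r₁-typed ; σ₂-typed = renSub-typed r₂-typed ; iso-at = iso-at }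

  conds-⊢f : ∀ i Ξ → (∀ {n e} → (Ξ ++ Γ) ∋ n ∶ e → (Δ ++ Γ) ∋ n + i ∶ renE (λ x → x + i) e) →
           bigCtx ⊢f foldr _∧'_ ⊤' (conds i Ξ)
  conds-⊢f i [] emb = top
  conds-⊢f i (obj ∷ Ξ) emb = and (IsIso-⊢f (ov (r₁-typed q)) (ov (r₂-typed q)) (α-⊢a q)) (conds-⊢f (suc i) Ξ emb')
    where
      q = emb here
      emb' : ∀ {n e} → (Ξ ++ Γ) ∋ n ∶ e → (Δ ++ Γ) ∋ n + suc i ∶ renE (λ x → x + suc i) e
      emb' {n} {e} p = cast-∋ (sym (+-suc n i)) (renE-shift-suc i e) (emb (there p))
  conds-⊢f i (arr a b ∷ Ξ) emb = and
      (subst (bigCtx ⊢f_) (cong₂ (λ x y → comp (av (r₂ i)) x ≐ comp y (av (r₁ i)))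
           (trans (component≡fTerm (renO (λ x → x + i) (renO suc a))) (cong fTerm (renO-shift-suc i a)))
           (trans (component≡fTerm (renO (λ x → x + i) (renO suc b))) (cong fTerm (renO-shift-suc i b))))
        (eq (comp (renSub-typed r₂-typed q) (component-⊢a copiesIso (proj₁ ab))) (comp (component-⊢a copiesIso (proj₂ ab)) (renSub-typed r₁-typed q))))
      (conds-⊢f (suc i) Ξ emb')
    where
      q = emb here
      ab = arr-⊢o (lookup-⊢e ⊢ΔΓ q)
      emb' : ∀ {n e} → (Ξ ++ Γ) ∋ n ∶ e → (Δ ++ Γ) ∋ n + suc i ∶ renE (λ x → x + suc i) e
      emb' {n} {e} p = cast-∋ (sym (+-suc n i)) (renE-shift-suc i e) (emb (there p))

  isCtxIso-⊢f : bigCtx ⊢f isCtxIso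
  isCtxIso-⊢f = conds-⊢f zero Δ (λ {n} {e} p → cast-∋ (sym (+-identityʳ n)) (sym (renE-+0 e)) p)

  bigCtx≡ : ctxIsoVars ++ Γ ≡ bigCtx
  bigCtx≡ = trans (++-assoc isoArrows (copy₂ ++ Δ) Γ) (cong (isoArrows ++_) (++-assoc copy₂ Δ Γ))

  P₁⇔P₂ : ∀ {P} → (Δ ++ Γ) ⊢f P → T ▸ bigCtx ∣ [] ⊢ isCtxIso ⇒' (P₁ P ⇔' P₂ P)
  P₁⇔P₂ {P} ⊢P = ⇒I isCtxIso-⊢f (∧I
      (cast⊢ (sym (cong₂ _⇒'_ (renF≡subF r₁ P) (renF≡subF r₂ P))) (proj₁ (transport copiesIso ⊢P)))
      (cast⊢ (sym (cong₂ _⇒'_ (renF≡subF r₂ P) (renF≡subF r₁ P))) (proj₂ (transport copiesIso ⊢P))))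

mainTheorem3 : (S : Signature) → let open Lang S in
    (T : Theory) (Γ Δ : Ctx) (P : Fm) →
    ⊢ctx (Δ ++ Γ) → (Δ ++ Γ) ⊢f P →
    T ▸ Γ ∣ [] ⊢ ∀* (Iso.ctxIsoVars Δ)
    (Iso.isCtxIso Δ ⇒' (Iso.P₁ Δ P ⇔' Iso.P₂ Δ P))
mainTheorem3 S T Γ Δ P ⊢ΔΓ ⊢P =
  ∀*-intro ctxIsoVars (subst ⊢ctx (sym bigCtx≡) ⊢bigCtx)
    (subst (λ Ξ → T ▸ Ξ ∣ [] ⊢ isCtxIso ⇒' (P₁ P ⇔' P₂ P)) (sym bigCtx≡) (P₁⇔P₂ ⊢P))
  where
    open Lang S
    open Derivations S T
    open CopyInstance S T Γ Δ ⊢ΔΓ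
    open Iso Δ
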